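{- Let $k\ge1$, $\mathbf t=(t_1,\dots,t_k)\in\mathbb Z^k$ with $t_k\neq 0$, let $\mathcal C(X)=X^k-t_1X^{k-1}-\dots-t_k$ and let $\mathbf A$ be the $k\times k$ companion matrix whose rows $1,\dots,k-1$ are the standard basis vectors $e_2,\dots,e_k$ and whose last row is $(t_k,t_{k-1},\dots,t_1)$. Then: (a) For every $n\in\mathbb Z$, the $(i,j)$ entry of $\mathbf A^n$ ($1\le i,j\le k$) equals $(-1)^{k-j}S_{(n-k+i,\,1^{k-j})}$. (b) For every root $\lambda$ of $\mathcal C$ and every $m\in\mathbb Z$, $\lambda^m=\sum_{j=0}^{k-1}(-1)^{k-1-j}S_{(m-k+1,\,1^{k-1-j})}\lambda^j$. (c) For each fixed $(i,j)$, the sequence $x_n=(\mathbf A^n)_{ij}$, $n\in\mathbb Z$, satisfies $x_n=\sum_{l=1}^k t_l x_{n-l}$ for all $n\in\mathbb Z$; in particular $(\mathbf A^n)_{k,k}=F_{k,n}(\mathbf t)$ for all $n\in\mathbb Z$. (d) For every $n\in\mathbb Z$, $\operatorname{tr}(\mathbf A^n)=G_{k,n}(\mathbf t)$, and the sequence $(G_{k,n}(\mathbf t))_{n\in\mathbb Z}$ satisfies the same recursion.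
   Context: Let $\lambda_1,\dots,\lambda_k\in\mathbb C$ be the roots of $\mathcal C$ with multiplicity. Put $e_0=1$, $e_j=(-1)^{j+1}t_j$ for $1\le j\le k$ (these are the elementary symmetric polynomials of the roots) and $e_j=0$ for $j>k$ or $j<0$. The Generalized Fibonacci Polynomials $F_{k,n}(\mathbf t)$, $n\in\mathbb Z$, are defined by $F_{k,0}=1$, $F_{k,-1}=\dots=F_{k,-(k-1)}=0$ and $F_{k,n}=\sum_{j=1}^k t_jF_{k,n-j}$ for all $n\in\mathbb Z$ (extended to negative $n$ using $t_k\ne0$; values in $\mathbb Q$); for $n\ge0$ they equal the complete symmetric polynomials $h_n(\lambda_1,\dots,\lambda_k)$. Write $h_n=F_{k,n}(\mathbf t)$ for all $n\in\mathbb Z$. For $a\in\mathbb Z$ and $b\ge0$ the (isobaric reflect of the) Schur-hook polynomial is $S_{(a,1^b)}=\sum_{i=0}^{b}(-1)^ih_{a+i}e_{b-i}$; for $a\ge1$ this is the Schur polynomial $s_{(a,1^b)}(\lambda_1,\dots,\lambda_k)$ expressed in $\mathbf t$. The Generalized Lucas Polynomials are $G_{k,n}(\mathbf t)=\sum_{i=1}^k\lambda_i^n$ (power sums of the roots), $n\in\mathbb Z$. -}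

module Defs where

open import Level using (0ℓ)
open import Data.Bool using (Bool; true; false; if_then_else_)
open import Data.Nat as ℕ using (ℕ; zero; suc; _∸_)
open import Data.Fin using (Fin; zero; suc; toℕ)
open import Data.Fin.Properties using () renaming (_≟_ to _≟F_)
open import Data.Integer as ℤ using (ℤ; +_; -[1+_])
open import Data.Rational as ℚ using (ℚ; 0ℚ; 1ℚ)
open import Data.Product using (Σ; _×_; ∃)
open import Function using (_∘_)
open import Relation.Nullary using (¬_; does)
open import Relation.Binary.PropositionalEquality using (_≡_)
open import Algebra.Bundles using (CommutativeRing)

sumℕ : {A : Set} → (A → A → A) → A → ℕ → (ℕ → A) → A
sumℕ _⊕_ z zero    f = z
sumℕ _⊕_ z (suc n) f = sumℕ _⊕_ z n f ⊕ f n

sumFin : {A : Set} → (A → A → A) → A → {n : ℕ} → (Fin n → A) → A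
sumFin _⊕_ z {zero}  f = z
sumFin _⊕_ z {suc n} f = f zero ⊕ sumFin _⊕_ z (f ∘ suc)

Σℚ : ℕ → (ℕ → ℚ) → ℚ
Σℚ = sumℕ ℚ._+_ 0ℚ

ΣFinℚ : {n : ℕ} → (Fin n → ℚ) → ℚ
ΣFinℚ = sumFin ℚ._+_ 0ℚ

-- The parameters t = (t_1,...,t_k), given as t : Fin k → ℤ with
-- t zero = t_1, ..., t (k-1) = t_k.

-- coef t j = t_j for 1 ≤ j ≤ k, and 0 for j = 0 or j > k.
coef : {k : ℕ} → (Fin k → ℤ) → ℕ → ℤ
coef {zero}  t j             = + 0
coef {suc k} t zero          = + 0
coef {suc k} t (suc zero)    = t zero
coef {suc k} t (suc (suc j)) = coef (t ∘ suc) (suc j)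

ℤ→ℚ : ℤ → ℚ
ℤ→ℚ z = z ℚ./ 1

tq : {k : ℕ} → (Fin k → ℤ) → ℕ → ℚ
tq t j = ℤ→ℚ (coef t j)

sgn : ℕ → ℚ
sgn zero    = 1ℚ
sgn (suc m) = ℚ.- sgn m

-- e_0 = 1, e_j = (-1)^{j+1} t_j (1 ≤ j ≤ k), e_j = 0 (j > k)
e : {k : ℕ} → (Fin k → ℤ) → ℕ → ℚ
e t zero    = 1ℚ
e t (suc j) = ℚ._*_ (sgn j) (tq t (suc j))   -- (-1)^{(j+1)+1} = (-1)^j

-- Schur-hook polynomial  S_{(a,1^b)} = Σ_{i=0}^b (-1)^i h_{a+i} e_{b-i},
-- where h : ℤ → ℚ is the sequence of Generalized Fibonacci Polynomials.
S : {k : ℕ} → (Fin k → ℤ) → (ℤ → ℚ) → ℤ → ℕ → ℚ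
S t h a b = Σℚ (suc b) (λ i → ℚ._*_ (ℚ._*_ (sgn i) (h (a ℤ.+ + i))) (e t (b ∸ i)))

IsGenFib : (k : ℕ) → (Fin k → ℤ) → (ℤ → ℚ) → Set
IsGenFib k t h =
  (h (+ 0) ≡ 1ℚ)
  × (∀ (i : ℕ) → 1 ℕ.≤ i → i ℕ.< k → h (ℤ.- (+ i)) ≡ 0ℚ)
  × (∀ (n : ℤ) → h n ≡ Σℚ k (λ j → ℚ._*_ (tq t (suc j)) (h (n ℤ.- + suc j))))

-- k × k rational matrices (indices 0..k-1 stand for 1..k)

Mat : ℕ → Set
Mat k = Fin k → Fin k → ℚ

_⊗_ : {k : ℕ} → Mat k → Mat k → Mat k
(M ⊗ N) i j = ΣFinℚ (λ l → ℚ._*_ (M i l) (N l j))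

Id : {k : ℕ} → Mat k
Id i j = if does (i ≟F j) then 1ℚ else 0ℚ

_^ᴹ_ : {k : ℕ} → Mat k → ℕ → Mat k
M ^ᴹ zero  = Id
M ^ᴹ suc n = M ⊗ (M ^ᴹ n)

powℤ : {k : ℕ} → Mat k → Mat k → ℤ → Mat k
powℤ M Minv (+ n)    = M ^ᴹ n
powℤ M Minv -[1+ n ] = Minv ^ᴹ suc n

IsInverse : {k : ℕ} → Mat k → Mat k → Set
IsInverse M N = (∀ i j → (M ⊗ N) i j ≡ Id i j) × (∀ i j → (N ⊗ M) i j ≡ Id i j)

trace : {k : ℕ} → Mat k → ℚ
trace M = ΣFinℚ (λ i → M i i)

-- Companion matrix: row i (1 ≤ i ≤ k-1) is the standard basis vector e_{i+1};
-- row k is (t_k, t_{k-1}, ..., t_1), i.e. entry (k, j) = t_{k+1-j}.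
companion : (k : ℕ) → (Fin k → ℤ) → Mat k
companion k t i j =
  if does (suc (toℕ i) ℕ.≟ k)
  then tq t (k ∸ toℕ j)
  else (if does (toℕ j ℕ.≟ suc (toℕ i)) then 1ℚ else 0ℚ)

module _ (K : CommutativeRing 0ℓ 0ℓ) where
  open CommutativeRing K using (Carrier; _≈_; _+_; _*_; -_; _-_; 0#; 1#)

  powK : Carrier → ℕ → Carrier
  powK x zero    = 1#
  powK x (suc n) = x * powK x n

  zpowK : Carrier → Carrier → ℤ → Carrier
  zpowK x y (+ n)    = powK x n
  zpowK x y -[1+ n ] = powK y (suc n)

  ΣK : ℕ → (ℕ → Carrier) → Carrier
  ΣK = sumℕ _+_ 0#

  ΣFinK : {n : ℕ} → (Fin n → Carrier) → Carrier
  ΣFinK = sumFin _+_ 0#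

  IsFieldCR : Set
  IsFieldCR = (¬ (1# ≈ 0#)) × (∀ x → ¬ (x ≈ 0#) → ∃ λ y → x * y ≈ 1#)

  -- coefficient list (as ℕ → K) of (X - a) · P
  mulLin : Carrier → (ℕ → Carrier) → ℕ → Carrier
  mulLin a P zero    = - (a * P zero)
  mulLin a P (suc d) = P d - a * P (suc d)

  -- coefficients of Π_{i} (X - λ_i)
  rootPoly : {n : ℕ} → (Fin n → Carrier) → ℕ → Carrier
  rootPoly {zero}  ls zero    = 1#
  rootPoly {zero}  ls (suc d) = 0#
  rootPoly {suc n} ls         = mulLin (ls zero) (rootPoly (ls ∘ suc))

  Ccoef : (k : ℕ) → (Fin k → ℤ) → (ℚ → Carrier) → ℕ → Carrier
  Ccoef k t φ d = if does (d ℕ.≟ k) then 1# else (- φ (tq t (k ∸ d)))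

  Ceval : (k : ℕ) → (Fin k → ℤ) → (ℚ → Carrier) → Carrier → Carrier
  Ceval k t φ x = ΣK (suc k) (λ d → Ccoef k t φ d * powK x d)

{-# OPTIONS --safe #-}
-- Write hook b a = (-1)^b S_(a,1^b).  Splitting off the first term of the defining sum gives
-- hook (b+1) a = hook b (a+1) - t_(b+1) h_a, so every hook sequence obeys the recursion of h, and
-- hook k vanishes identically.  The proposed matrices Q_n (i,j) = hook (k-1-j) (n-k+1+i) thus satisfy
-- A Q_n = Q_(n+1): rows 1..k-1 of A shift i, its last row is the recursion.  The initial values of h
-- give Q_0 = I, hence Q_n = A^n for n ≥ 0, and A⁻¹ A = I extends this to n < 0; (c) is the recursion.
-- Since t_k is invertible, a solution of the recursion is fixed by k consecutive values; for (b),
-- m ↦ λ^m and m ↦ Σ_j Q_m (1,j) λ^j are solutions agreeing for 0 ≤ m < k.  For (d), each diagonal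
-- hook is a convolution of h with coefficients C_v of C; summing the diagonal weights C_v by v,
-- Newton's identities v C_v = Σ_r C_(v+r) p_r rewrite the trace as Σ_j p_(j+1) Q_(n-1) (1,j), and
-- (b) evaluates this to Σ_i λ_i^n.
module Submission where

open import Defs
open import Level using (0ℓ)
open import Algebra.Bundles using (CommutativeRing)
open import Algebra.Morphism.Structures using (IsRingHomomorphism)
import Algebra.Solver.Ring
open import Algebra.Solver.Ring.AlmostCommutativeRing
  using (fromCommutativeRing; _-Raw-AlmostCommutative⟶_)
open import Data.Bool using (true; false; if_then_else_)
open import Data.Maybe using (Maybe; just; nothing)
open import Data.Nat as ℕ using (ℕ; zero; suc; _∸_; _<_; _≤_; z≤n; s≤s)
import Data.Nat.Properties as ℕ
open import Data.Fin using (Fin; toℕ) renaming (zero to fzero; suc to fsuc)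
import Data.Fin.Properties as Fin
open import Data.Integer as ℤ using (ℤ; +_; -[1+_]; _⊖_)
import Data.Integer.Properties as ℤ
open import Data.Integer.Tactic.RingSolver using (solve-∀)
open import Data.Rational as ℚ using (ℚ; 0ℚ; 1ℚ)
import Data.Rational.Properties as ℚ
open import Data.Product using (_,_; ∃; proj₁; proj₂)
open import Function using (_∘_; id)
open import Relation.Nullary using (¬_; does; yes; no)
open import Relation.Nullary.Decidable using (dec-true; dec-false)
open import Relation.Binary.PropositionalEquality as ≡ using (_≡_; _≢_)

-- The ring solver normalises coefficients and must decide when one vanishes (as in x - x = 0),
-- so it runs with integer coefficients mapped canonically into R.
module ℤ-Coefficients (R : CommutativeRing 0ℓ 0ℓ) where
  open CommutativeRing R
  open import Algebra.Properties.Semiring.Mult semiring using (_×_; ×-homo-+; ×1-homo-*)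
  open import Algebra.Properties.Ring ring using (-0#≈0#; -‿distribˡ-*; -‿distribʳ-*)
  open import Algebra.Properties.AbelianGroup +-abelianGroup using (⁻¹-∙-comm; ⁻¹-involutive)
  open import Relation.Binary.Reasoning.Setoid setoid

  ⟦_⟧ : ℤ → Carrier
  ⟦ + n ⟧      = n × 1#
  ⟦ -[1+ n ] ⟧ = - (suc n × 1#)

  -‿homo : ∀ i → ⟦ ℤ.- i ⟧ ≈ - ⟦ i ⟧
  -‿homo (+ zero)  = sym -0#≈0#
  -‿homo (+ suc n) = refl
  -‿homo -[1+ n ]  = sym (⁻¹-involutive _)

  private
    1+a-[1+b]≈a-b : ∀ a b → (1# + a) - (1# + b) ≈ a - b
    1+a-[1+b]≈a-b a b = begin
      (1# + a) - (1# + b)      ≈⟨ +-cong (+-comm 1# a) (sym (⁻¹-∙-comm 1# b)) ⟩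
      (a + 1#) + (- 1# - b)    ≈⟨ +-assoc a 1# _ ⟩
      a + (1# + (- 1# - b))    ≈⟨ +-congˡ (sym (+-assoc 1# (- 1#) _)) ⟩
      a + ((1# - 1#) - b)      ≈⟨ +-congˡ (+-congʳ (-‿inverseʳ 1#)) ⟩
      a + (0# - b)             ≈⟨ +-congˡ (+-identityˡ _) ⟩
      a - b                    ∎

  ⊖-homo : ∀ m n → ⟦ m ⊖ n ⟧ ≈ m × 1# - n × 1#
  ⊖-homo zero    zero    = sym (-‿inverseʳ 0#)
  ⊖-homo zero    (suc n) = sym (+-identityˡ _)
  ⊖-homo (suc m) zero    = sym (trans (+-congˡ -0#≈0#) (+-identityʳ _))
  ⊖-homo (suc m) (suc n) = begin
    ⟦ suc m ⊖ suc n ⟧   ≡⟨ ≡.cong ⟦_⟧ (ℤ.[1+m]⊖[1+n]≡m⊖n m n) ⟩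
    ⟦ m ⊖ n ⟧           ≈⟨ ⊖-homo m n ⟩
    m × 1# - n × 1#     ≈⟨ 1+a-[1+b]≈a-b _ _ ⟨
    suc m × 1# - suc n × 1# ∎

  +-homo : ∀ i j → ⟦ i ℤ.+ j ⟧ ≈ ⟦ i ⟧ + ⟦ j ⟧
  +-homo (+ m)    (+ n)    = ×-homo-+ 1# m n
  +-homo (+ m)    -[1+ n ] = ⊖-homo m (suc n)
  +-homo -[1+ m ] (+ n)    = trans (⊖-homo n (suc m)) (+-comm _ _)
  +-homo -[1+ m ] -[1+ n ] = begin
    - (suc (suc (m ℕ.+ n)) × 1#)         ≡⟨ ≡.cong (λ l → - (suc l × 1#)) (ℕ.+-suc m n) ⟨
    - ((suc m ℕ.+ suc n) × 1#)           ≈⟨ -‿cong (×-homo-+ 1# (suc m) (suc n)) ⟩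
    - (suc m × 1# + suc n × 1#)          ≈⟨ ⁻¹-∙-comm _ _ ⟨
    - (suc m × 1#) + - (suc n × 1#)      ∎

  private
    *-homo-+ : ∀ m j → ⟦ + m ℤ.* j ⟧ ≈ ⟦ + m ⟧ * ⟦ j ⟧
    *-homo-+ m (+ n)    = trans (reflexive (≡.cong ⟦_⟧ (≡.sym (ℤ.pos-* m n)))) (×1-homo-* m n)
    *-homo-+ m -[1+ n ] = begin
      ⟦ + m ℤ.* ℤ.- + suc n ⟧     ≡⟨ ≡.cong ⟦_⟧ (ℤ.neg-distribʳ-* (+ m) (+ suc n)) ⟨
      ⟦ ℤ.- (+ m ℤ.* + suc n) ⟧   ≈⟨ -‿homo (+ m ℤ.* + suc n) ⟩
      - ⟦ + m ℤ.* + suc n ⟧       ≈⟨ -‿cong (*-homo-+ m (+ suc n)) ⟩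
      - (⟦ + m ⟧ * ⟦ + suc n ⟧)   ≈⟨ -‿distribʳ-* _ _ ⟩
      ⟦ + m ⟧ * - ⟦ + suc n ⟧     ∎

  *-homo : ∀ i j → ⟦ i ℤ.* j ⟧ ≈ ⟦ i ⟧ * ⟦ j ⟧
  *-homo (+ m)    j = *-homo-+ m j
  *-homo -[1+ m ] j = begin
    ⟦ ℤ.- + suc m ℤ.* j ⟧       ≡⟨ ≡.cong ⟦_⟧ (ℤ.neg-distribˡ-* (+ suc m) j) ⟨
    ⟦ ℤ.- (+ suc m ℤ.* j) ⟧     ≈⟨ -‿homo (+ suc m ℤ.* j) ⟩
    - ⟦ + suc m ℤ.* j ⟧         ≈⟨ -‿cong (*-homo-+ (suc m) j) ⟩
    - (⟦ + suc m ⟧ * ⟦ j ⟧)     ≈⟨ -‿distribˡ-* _ _ ⟩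
    ⟦ -[1+ m ] ⟧ * ⟦ j ⟧        ∎

  ℤ-morphism : ℤ.+-*-rawRing -Raw-AlmostCommutative⟶ fromCommutativeRing R
  ℤ-morphism = record
    { ⟦_⟧ = ⟦_⟧ ; +-homo = +-homo ; *-homo = *-homo ; -‿homo = -‿homo
    ; 0-homo = refl ; 1-homo = +-identityʳ 1# }

  ⟦⟧-≟ : ∀ i j → Maybe (⟦ i ⟧ ≈ ⟦ j ⟧)
  ⟦⟧-≟ i j with i ℤ.≟ j
  ... | yes ≡.refl = just refl
  ... | no _       = nothing

  open Algebra.Solver.Ring ℤ.+-*-rawRing (fromCommutativeRing R) ℤ-morphism ⟦⟧-≟ public
    using (solve; _:+_; _:*_; _:-_; :-_; _:=_; con)


module Sums (R : CommutativeRing 0ℓ 0ℓ) where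
  open CommutativeRing R
  open import Algebra.Properties.CommutativeSemigroup +-commutativeSemigroup using (interchange)
  open import Algebra.Properties.AbelianGroup +-abelianGroup using (⁻¹-∙-comm)
  open import Algebra.Properties.Ring ring using (-0#≈0#)
  open import Relation.Binary.Reasoning.Setoid setoid

  Σ : ℕ → (ℕ → Carrier) → Carrier
  Σ = sumℕ _+_ 0#

  ΣF : ∀ {n} → (Fin n → Carrier) → Carrier
  ΣF = sumFin _+_ 0#

  Σ-cong : ∀ n {f g : ℕ → Carrier} → (∀ i → i < n → f i ≈ g i) → Σ n f ≈ Σ n g
  Σ-cong zero    f≈g = refl
  Σ-cong (suc n) f≈g = +-cong (Σ-cong n (λ i i<n → f≈g i (ℕ.m<n⇒m<1+n i<n))) (f≈g n ℕ.≤-refl)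

  Σ-zero : ∀ n {f : ℕ → Carrier} → (∀ i → i < n → f i ≈ 0#) → Σ n f ≈ 0#
  Σ-zero zero    f≈0 = refl
  Σ-zero (suc n) f≈0 =
    trans (+-cong (Σ-zero n (λ i i<n → f≈0 i (ℕ.m<n⇒m<1+n i<n))) (f≈0 n ℕ.≤-refl)) (+-identityˡ 0#)

  Σ-distrib-+ : ∀ n (f g : ℕ → Carrier) → Σ n (λ i → f i + g i) ≈ Σ n f + Σ n g
  Σ-distrib-+ zero    f g = sym (+-identityˡ 0#)
  Σ-distrib-+ (suc n) f g = trans (+-congʳ (Σ-distrib-+ n f g)) (interchange _ _ _ _)

  Σ-neg : ∀ n (f : ℕ → Carrier) → Σ n (λ i → - f i) ≈ - Σ n f
  Σ-neg zero    f = sym -0#≈0#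
  Σ-neg (suc n) f = trans (+-congʳ (Σ-neg n f)) (⁻¹-∙-comm _ _)

  Σ-distrib-- : ∀ n (f g : ℕ → Carrier) → Σ n (λ i → f i - g i) ≈ Σ n f - Σ n g
  Σ-distrib-- n f g = trans (Σ-distrib-+ n f (λ i → - g i)) (+-congˡ (Σ-neg n g))

  *-distribˡ-Σ : ∀ n x (f : ℕ → Carrier) → x * Σ n f ≈ Σ n (λ i → x * f i)
  *-distribˡ-Σ zero    x f = zeroʳ x
  *-distribˡ-Σ (suc n) x f = trans (distribˡ x _ _) (+-congʳ (*-distribˡ-Σ n x f))

  *-distribʳ-Σ : ∀ n x (f : ℕ → Carrier) → Σ n f * x ≈ Σ n (λ i → f i * x)
  *-distribʳ-Σ zero    x f = zeroˡ x
  *-distribʳ-Σ (suc n) x f = trans (distribʳ x _ _) (+-congʳ (*-distribʳ-Σ n x f))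

  Σ-head : ∀ n (f : ℕ → Carrier) → Σ (suc n) f ≈ f 0 + Σ n (f ∘ suc)
  Σ-head zero    f = trans (+-identityˡ _) (sym (+-identityʳ _))
  Σ-head (suc n) f = trans (+-congʳ (Σ-head n f)) (+-assoc _ _ _)

  Σ-last-zero : ∀ n (f : ℕ → Carrier) → f n ≈ 0# → Σ (suc n) f ≈ Σ n f
  Σ-last-zero n f fn≈0 = trans (+-congˡ fn≈0) (+-identityʳ _)

  Σ-comm : ∀ m n (f : ℕ → ℕ → Carrier) → Σ m (λ i → Σ n (f i)) ≈ Σ n (λ j → Σ m (λ i → f i j))
  Σ-comm zero    n f = sym (Σ-zero n (λ _ _ → refl))
  Σ-comm (suc m) n f = trans (+-congʳ (Σ-comm m n f)) (sym (Σ-distrib-+ n _ (f m)))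

  Σ-reverse : ∀ n (f : ℕ → Carrier) → Σ n (λ i → f (n ∸ suc i)) ≈ Σ n f
  Σ-reverse zero    f = refl
  Σ-reverse (suc n) f = trans (Σ-head n _) (trans (+-comm _ _) (+-congʳ (Σ-reverse n f)))

  Σ-select : ∀ n m (δ g : ℕ → Carrier) → m < n → δ m ≈ 1# → (∀ l → l ≢ m → δ l ≈ 0#) →
             Σ n (λ l → δ l * g l) ≈ g m
  Σ-select (suc n) m δ g m<1+n δm≈1 δl≈0 with m ℕ.≟ n
  ... | yes ≡.refl = begin
    Σ n (λ l → δ l * g l) + δ m * g m  ≈⟨ +-cong (Σ-zero n (λ l l<m → off l (ℕ.<⇒≢ l<m))) (*-congʳ δm≈1) ⟩
    0# + 1# * g m                      ≈⟨ trans (+-identityˡ _) (*-identityˡ _) ⟩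
    g m                                ∎
    where
    off : ∀ l → l ≢ m → δ l * g l ≈ 0#
    off l l≢m = trans (*-congʳ (δl≈0 l l≢m)) (zeroˡ _)
  ... | no m≢n = trans (+-cong (Σ-select n m δ g (ℕ.≤∧≢⇒< (ℕ.≤-pred m<1+n) m≢n) δm≈1 δl≈0)
                              (trans (*-congʳ (δl≈0 n (m≢n ∘ ≡.sym))) (zeroˡ _)))
                       (+-identityʳ _)

  ΣF-cong : ∀ n {f g : Fin n → Carrier} → (∀ i → f i ≈ g i) → ΣF f ≈ ΣF g
  ΣF-cong zero    f≈g = refl
  ΣF-cong (suc n) f≈g = +-cong (f≈g fzero) (ΣF-cong n (f≈g ∘ fsuc))

  ΣF-toℕ : ∀ n (f : ℕ → Carrier) → ΣF {n} (f ∘ toℕ) ≈ Σ n f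
  ΣF-toℕ zero    f = refl
  ΣF-toℕ (suc n) f = trans (+-congˡ (ΣF-toℕ n (f ∘ suc))) (sym (Σ-head n f))

  ΣF-zero : ∀ n → ΣF {n} (λ _ → 0#) ≈ 0#
  ΣF-zero zero    = refl
  ΣF-zero (suc n) = trans (+-identityˡ _) (ΣF-zero n)

  ΣF-distrib-+ : ∀ n (f g : Fin n → Carrier) → ΣF (λ i → f i + g i) ≈ ΣF f + ΣF g
  ΣF-distrib-+ zero    f g = sym (+-identityˡ 0#)
  ΣF-distrib-+ (suc n) f g = trans (+-congˡ (ΣF-distrib-+ n (f ∘ fsuc) (g ∘ fsuc))) (interchange _ _ _ _)

  *-distribˡ-ΣF : ∀ n x (f : Fin n → Carrier) → x * ΣF f ≈ ΣF (λ i → x * f i)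
  *-distribˡ-ΣF zero    x f = zeroʳ x
  *-distribˡ-ΣF (suc n) x f = trans (distribˡ x _ _) (+-congˡ (*-distribˡ-ΣF n x (f ∘ fsuc)))

  *-distribʳ-ΣF : ∀ n x (f : Fin n → Carrier) → ΣF f * x ≈ ΣF (λ i → f i * x)
  *-distribʳ-ΣF zero    x f = zeroˡ x
  *-distribʳ-ΣF (suc n) x f = trans (distribʳ x _ _) (+-congˡ (*-distribʳ-ΣF n x (f ∘ fsuc)))

  ΣF-comm : ∀ m n (f : Fin m → Fin n → Carrier) → ΣF (λ i → ΣF (f i)) ≈ ΣF (λ j → ΣF (λ i → f i j))
  ΣF-comm zero    n f = sym (ΣF-zero n)
  ΣF-comm (suc m) n f = trans (+-congˡ (ΣF-comm m n (f ∘ fsuc))) (sym (ΣF-distrib-+ n (f fzero) _))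

  ΣF-Σ-comm : ∀ m n (f : Fin m → ℕ → Carrier) → ΣF (λ i → Σ n (f i)) ≈ Σ n (λ j → ΣF (λ i → f i j))
  ΣF-Σ-comm zero    n f = sym (Σ-zero n (λ _ _ → refl))
  ΣF-Σ-comm (suc m) n f = trans (+-congˡ (ΣF-Σ-comm m n (f ∘ fsuc))) (sym (Σ-distrib-+ n (f fzero) _))

private
  +[m∸n]≡m-n : ∀ m n → n ≤ m → + (m ∸ n) ≡ + m ℤ.- + n
  +[m∸n]≡m-n m n n≤m = ≡.trans (≡.sym (ℤ.⊖-≥ n≤m)) (≡.sym (ℤ.m-n≡m⊖n m n))

module LinearRecurrences (R : CommutativeRing 0ℓ 0ℓ) where
  open CommutativeRing R
  open Sums R
  open import Algebra.Properties.Ring ring using (x[y-z]≈xy-xz)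
  open import Algebra.Properties.CommutativeSemigroup *-commutativeSemigroup using (x∙yz≈y∙xz)
  open import Relation.Binary.Reasoning.Setoid setoid

  record LinRec (k : ℕ) (c : ℕ → Carrier) (x : ℤ → Carrier) : Set where
    constructor linRec
    field recur : ∀ n → x n ≈ Σ k (λ l → c l * x (n ℤ.- + suc l))

  open LinRec public

  private
    [n+d]-s≡[n-s]+d : ∀ n d s → (n ℤ.+ d) ℤ.- s ≡ (n ℤ.- s) ℤ.+ d
    [n+d]-s≡[n-s]+d = solve-∀

  module _ {k : ℕ} {c : ℕ → Carrier} where

    LinRec-resp : ∀ {x y} → (∀ n → x n ≈ y n) → LinRec k c x → LinRec k c y
    LinRec-resp x≈y rx = linRec λ n → trans (sym (x≈y n)) (trans (recur rx n) (Σ-cong k (λ l _ → *-congˡ (x≈y _))))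

    LinRec-shift : ∀ {x} d → LinRec k c x → LinRec k c (λ n → x (n ℤ.+ d))
    LinRec-shift {x} d rx = linRec λ n →
      trans (recur rx (n ℤ.+ d)) (Σ-cong k (λ l _ → *-congˡ (reflexive (≡.cong x ([n+d]-s≡[n-s]+d n d _)))))

    LinRec-* : ∀ {x} a → LinRec k c x → LinRec k c (λ n → a * x n)
    LinRec-* {x} a rx = linRec λ n → begin
      a * x n                                           ≈⟨ *-congˡ (recur rx n) ⟩
      a * Σ k (λ l → c l * x (n ℤ.- + suc l))           ≈⟨ *-distribˡ-Σ k a _ ⟩
      Σ k (λ l → a * (c l * x (n ℤ.- + suc l)))         ≈⟨ Σ-cong k (λ l _ → x∙yz≈y∙xz a (c l) _) ⟩
      Σ k (λ l → c l * (a * x (n ℤ.- + suc l)))         ∎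

    LinRec-− : ∀ {x y} → LinRec k c x → LinRec k c y → LinRec k c (λ n → x n - y n)
    LinRec-− {x} {y} rx ry = linRec λ n → begin
      x n - y n                                                 ≈⟨ +-cong (recur rx n) (-‿cong (recur ry n)) ⟩
      Σ k (λ l → c l * x (n ℤ.- + suc l)) - Σ k (λ l → c l * y (n ℤ.- + suc l))
                                                                ≈⟨ Σ-distrib-- k _ _ ⟨
      Σ k (λ l → c l * x (n ℤ.- + suc l) - c l * y (n ℤ.- + suc l))
                                                                ≈⟨ Σ-cong k (λ l _ → x[y-z]≈xy-xz (c l) _ _) ⟨
      Σ k (λ l → c l * (x (n ℤ.- + suc l) - y (n ℤ.- + suc l))) ∎

    LinRec-Σ : ∀ m {x : ℕ → ℤ → Carrier} → (∀ j → LinRec k c (x j)) → LinRec k c (λ n → Σ m (λ j → x j n))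
    LinRec-Σ m {x} rx = linRec λ n → begin
      Σ m (λ j → x j n)                                         ≈⟨ Σ-cong m (λ j _ → recur (rx j) n) ⟩
      Σ m (λ j → Σ k (λ l → c l * x j (n ℤ.- + suc l)))         ≈⟨ Σ-comm m k _ ⟩
      Σ k (λ l → Σ m (λ j → c l * x j (n ℤ.- + suc l)))         ≈⟨ Σ-cong k (λ l _ → *-distribˡ-Σ m (c l) _) ⟨
      Σ k (λ l → c l * Σ m (λ j → x j (n ℤ.- + suc l)))         ∎

  private
    [N+1]+m≡N+[1+m] : ∀ N m → (N ℤ.+ + 1) ℤ.+ m ≡ N ℤ.+ (+ 1 ℤ.+ m)
    [N+1]+m≡N+[1+m] = solve-∀
    [N-1]+[1+m]≡N+m : ∀ N m → (N ℤ.- + 1) ℤ.+ (+ 1 ℤ.+ m) ≡ N ℤ.+ m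
    [N-1]+[1+m]≡N+m = solve-∀
    [N+1]+K-[1+l]≡N+[K-l] : ∀ N K l → (N ℤ.+ + 1) ℤ.+ K ℤ.- (+ 1 ℤ.+ l) ≡ N ℤ.+ (K ℤ.- l)
    [N+1]+K-[1+l]≡N+[K-l] = solve-∀
    N+K-[1+l]≡N+[K-[1+l]] : ∀ N K l → N ℤ.+ K ℤ.- (+ 1 ℤ.+ l) ≡ N ℤ.+ (K ℤ.- (+ 1 ℤ.+ l))
    N+K-[1+l]≡N+[K-[1+l]] = solve-∀
    N+K-[1+K]≡[N-1]+0 : ∀ N K → N ℤ.+ K ℤ.- (+ 1 ℤ.+ K) ≡ (N ℤ.- + 1) ℤ.+ + 0
    N+K-[1+K]≡[N-1]+0 = solve-∀
    -n-1≡-[1+n] : ∀ n → ℤ.- n ℤ.- + 1 ≡ ℤ.- (+ 1 ℤ.+ n)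
    -n-1≡-[1+n] = solve-∀

  module _ {k′ : ℕ} {c : ℕ → Carrier} {x : ℤ → Carrier} (rx : LinRec (suc k′) c x) where
    private
      x-cong : ∀ {a b} → a ≡ b → x a ≈ x b
      x-cong = reflexive ∘ ≡.cong x

    ZeroWindow : ℤ → Set
    ZeroWindow N = ∀ m → m < suc k′ → x (N ℤ.+ + m) ≈ 0#

    ZeroWindow-suc : ∀ N → ZeroWindow N → ZeroWindow (N ℤ.+ + 1)
    ZeroWindow-suc N w m m<k with m ℕ.≟ k′
    ... | no m≢k′    = trans (x-cong ([N+1]+m≡N+[1+m] N (+ m))) (w (suc m) (s≤s (ℕ.≤∧≢⇒< (ℕ.≤-pred m<k) m≢k′)))
    ... | yes ≡.refl = trans (recur rx _) (Σ-zero (suc k′) (λ l l<k → trans (*-congˡ (earlier l l<k)) (zeroʳ _)))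
      where
      earlier : ∀ l → l < suc k′ → x ((N ℤ.+ + 1) ℤ.+ + k′ ℤ.- + suc l) ≈ 0#
      earlier l l<k = trans (x-cong (≡.trans ([N+1]+K-[1+l]≡N+[K-l] N (+ k′) (+ l))
                                             (≡.cong (λ z → N ℤ.+ z) (≡.sym (+[m∸n]≡m-n k′ l (ℕ.≤-pred l<k))))))
                            (w (k′ ∸ l) (s≤s (ℕ.m∸n≤m k′ l)))

    ZeroWindow-pred : (∃ λ u → u * c k′ ≈ 1#) → ∀ N → ZeroWindow N → ZeroWindow (N ℤ.- + 1)
    ZeroWindow-pred _          N w (suc m) 1+m<k = trans (x-cong ([N-1]+[1+m]≡N+m N (+ m))) (w m (ℕ.m<n⇒m<1+n (ℕ.≤-pred 1+m<k)))
    ZeroWindow-pred (u , uc≈1) N w zero    _     = begin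
      x₋                ≈⟨ *-identityˡ _ ⟨
      1# * x₋           ≈⟨ *-congʳ uc≈1 ⟨
      (u * c k′) * x₋   ≈⟨ *-assoc _ _ _ ⟩
      u * (c k′ * x₋)   ≈⟨ *-congˡ last≈0 ⟩
      u * 0#            ≈⟨ zeroʳ u ⟩
      0#                ∎
      where
      x₋ = x ((N ℤ.- + 1) ℤ.+ + 0)
      others≈0 : Σ k′ (λ l → c l * x (N ℤ.+ + k′ ℤ.- + suc l)) ≈ 0#
      others≈0 = Σ-zero k′ (λ l l<k′ → trans (*-congˡ (trans
                   (x-cong (≡.trans (N+K-[1+l]≡N+[K-[1+l]] N (+ k′) (+ l))
                                    (≡.cong (λ z → N ℤ.+ z) (≡.sym (+[m∸n]≡m-n k′ (suc l) l<k′)))))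
                   (w (k′ ∸ suc l) (s≤s (ℕ.m∸n≤m k′ (suc l)))))) (zeroʳ _))
      last≈0 : c k′ * x₋ ≈ 0#
      last≈0 = begin
        c k′ * x₋                                                 ≈⟨ *-congˡ (x-cong (N+K-[1+K]≡[N-1]+0 N (+ k′))) ⟨
        c k′ * x (N ℤ.+ + k′ ℤ.- + suc k′)                        ≈⟨ +-identityˡ _ ⟨
        0# + c k′ * x (N ℤ.+ + k′ ℤ.- + suc k′)                   ≈⟨ +-congʳ others≈0 ⟨
        Σ (suc k′) (λ l → c l * x (N ℤ.+ + k′ ℤ.- + suc l))       ≈⟨ recur rx (N ℤ.+ + k′) ⟨
        x (N ℤ.+ + k′)                                            ≈⟨ w k′ ℕ.≤-refl ⟩
        0#                                                        ∎

    LinRec-zero : (∃ λ u → u * c k′ ≈ 1#) → ZeroWindow (+ 0) → ∀ n → x n ≈ 0#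
    LinRec-zero unit x₀≈0 n@(+ m)      = trans (x-cong (≡.sym (ℤ.+-identityʳ n))) (forward m 0 (s≤s z≤n))
      where
      forward : ∀ n → ZeroWindow (+ n)
      forward zero    = x₀≈0
      forward (suc n) = ≡.subst ZeroWindow (≡.cong +_ (ℕ.+-comm n 1)) (ZeroWindow-suc (+ n) (forward n))
    LinRec-zero unit x₀≈0 n@(-[1+ m ]) = trans (x-cong (≡.sym (ℤ.+-identityʳ n))) (backward (suc m) 0 (s≤s z≤n))
      where
      backward : ∀ n → ZeroWindow (ℤ.- + n)
      backward zero    = x₀≈0
      backward (suc n) = ≡.subst ZeroWindow (-n-1≡-[1+n] (+ n)) (ZeroWindow-pred unit (ℤ.- + n) (backward n))

  LinRec-unique : ∀ {k′ c x y} → LinRec (suc k′) c x → LinRec (suc k′) c y → (∃ λ u → u * c k′ ≈ 1#) →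
                  (∀ m → m < suc k′ → x (+ m) ≈ y (+ m)) → ∀ n → x n ≈ y n
  LinRec-unique rx ry unit x₀≈y₀ n =
    x∙y⁻¹≈ε⇒x≈y _ _ (LinRec-zero (LinRec-− rx ry) unit (λ m m<k → x≈y⇒x∙y⁻¹≈ε (x₀≈y₀ m m<k)) n)
    where open import Algebra.Properties.Group +-group using (x∙y⁻¹≈ε⇒x≈y; x≈y⇒x∙y⁻¹≈ε)

module UnitPowers (R : CommutativeRing 0ℓ 0ℓ) (u u⁻¹ : CommutativeRing.Carrier R)
                  (u*u⁻¹≈1 : CommutativeRing._≈_ R (CommutativeRing._*_ R u u⁻¹) (CommutativeRing.1# R)) where
  open CommutativeRing R
  open Sums R
  open LinearRecurrences R
  open import Relation.Binary.Reasoning.Setoid setoid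

  zpow : ℤ → Carrier
  zpow = zpowK R u u⁻¹

  private
    u*[u⁻¹*x]≈x : ∀ x → u * (u⁻¹ * x) ≈ x
    u*[u⁻¹*x]≈x x = trans (sym (*-assoc _ _ _)) (trans (*-congʳ u*u⁻¹≈1) (*-identityˡ x))

    N+[1+j]≡[N+j]+1 : ∀ N j → N ℤ.+ (+ 1 ℤ.+ j) ≡ (N ℤ.+ j) ℤ.+ + 1
    N+[1+j]≡[N+j]+1 = solve-∀
    [N-k]+k≡N : ∀ N k → (N ℤ.- k) ℤ.+ k ≡ N
    [N-k]+k≡N = solve-∀
    N-k+[k-l]≡N-l : ∀ N k l → N ℤ.- k ℤ.+ (k ℤ.- l) ≡ N ℤ.- l
    N-k+[k-l]≡N-l = solve-∀

  zpow-suc : ∀ N → zpow (N ℤ.+ + 1) ≈ u * zpow N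
  zpow-suc (+ n)            = reflexive (≡.cong (powK R u) (ℕ.+-comm n 1))
  zpow-suc -[1+ zero ]      = sym (u*[u⁻¹*x]≈x 1#)
  zpow-suc -[1+ suc m ]     = sym (u*[u⁻¹*x]≈x _)

  zpow-+ : ∀ N j → zpow (N ℤ.+ + j) ≈ powK R u j * zpow N
  zpow-+ N zero    = trans (reflexive (≡.cong zpow (ℤ.+-identityʳ N))) (sym (*-identityˡ _))
  zpow-+ N (suc j) = begin
    zpow (N ℤ.+ + suc j)              ≡⟨ ≡.cong zpow (N+[1+j]≡[N+j]+1 N (+ j)) ⟩
    zpow ((N ℤ.+ + j) ℤ.+ + 1)        ≈⟨ zpow-suc (N ℤ.+ + j) ⟩
    u * zpow (N ℤ.+ + j)              ≈⟨ *-congˡ (zpow-+ N j) ⟩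
    u * (powK R u j * zpow N)         ≈⟨ *-assoc _ _ _ ⟨
    powK R u (suc j) * zpow N         ∎

  zpow-LinRec : ∀ k (a : ℕ → Carrier) → powK R u k ≈ Σ k (λ d → a (k ∸ d) * powK R u d) → LinRec k (a ∘ suc) zpow
  zpow-LinRec k a char = linRec recurrence
    where
    recurrence : ∀ N → zpow N ≈ Σ k (λ l → a (suc l) * zpow (N ℤ.- + suc l))
    recurrence N = begin
      zpow N                                                  ≡⟨ ≡.cong zpow ([N-k]+k≡N N (+ k)) ⟨
      zpow (M ℤ.+ + k)                                        ≈⟨ zpow-+ M k ⟩
      powK R u k * zpow M                                     ≈⟨ *-congʳ char ⟩
      Σ k (λ d → a (k ∸ d) * powK R u d) * zpow M             ≈⟨ *-distribʳ-Σ k _ _ ⟩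
      Σ k (λ d → (a (k ∸ d) * powK R u d) * zpow M)           ≈⟨ Σ-cong k (λ d _ → trans (*-assoc _ _ _) (*-congˡ (sym (zpow-+ M d)))) ⟩
      Σ k (λ d → a (k ∸ d) * zpow (M ℤ.+ + d))                ≈⟨ Σ-reverse k _ ⟨
      Σ k (λ l → a (k ∸ (k ∸ suc l)) * zpow (M ℤ.+ + (k ∸ suc l)))
                                                              ≈⟨ Σ-cong k (λ l l<k → *-cong (reflexive (≡.cong a (ℕ.m∸[m∸n]≡n l<k)))
                                                                   (reflexive (≡.cong zpow (reindex l l<k)))) ⟩
      Σ k (λ l → a (suc l) * zpow (N ℤ.- + suc l))            ∎
      where
      M = N ℤ.- + k
      reindex : ∀ l → l < k → M ℤ.+ + (k ∸ suc l) ≡ N ℤ.- + suc l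
      reindex l l<k = ≡.trans (≡.cong (λ z → M ℤ.+ z) (+[m∸n]≡m-n k (suc l) l<k)) (N-k+[k-l]≡N-l N (+ k) (+ suc l))

module RootPolynomials (R : CommutativeRing 0ℓ 0ℓ) where
  open CommutativeRing R
  open Sums R
  open ℤ-Coefficients R using (solve; _:+_; _:*_; _:-_; :-_; _:=_; con)
  open import Algebra.Properties.Semiring.Mult semiring using (_×_; ×-congʳ; ×-comm-*)
  open import Algebra.Properties.CommutativeMonoid.Mult +-commutativeMonoid using (×-distrib-+)
  open import Algebra.Properties.Ring ring using (-0#≈0#; -‿distribˡ-*)
  open import Relation.Binary.Reasoning.Setoid setoid

  eval : (ℕ → Carrier) → ℕ → Carrier → Carrier
  eval g N x = Σ N (λ r → g r * powK R x r)

  powerSum : ∀ {n} → (Fin n → Carrier) → ℕ → Carrier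
  powerSum xs r = ΣF (λ i → powK R (xs i) r)

  rootPoly-high : ∀ {n} (xs : Fin n → Carrier) d → n < d → rootPoly R xs d ≈ 0#
  rootPoly-high {zero}  xs (suc d) _         = refl
  rootPoly-high {suc n} xs (suc d) (s≤s n<d) = begin
    g d - xs fzero * g (suc d)   ≈⟨ +-cong (rootPoly-high _ d n<d) (-‿cong (*-congˡ (rootPoly-high _ (suc d) (ℕ.m<n⇒m<1+n n<d)))) ⟩
    0# - xs fzero * 0#           ≈⟨ solve 1 (λ a → con (+ 0) :- a :* con (+ 0) := con (+ 0)) refl (xs fzero) ⟩
    0#                           ∎
    where g = rootPoly R (xs ∘ fsuc)

  eval-mulLin : ∀ a g x N → eval (mulLin R a g) (suc N) x ≈ x * eval g N x - a * eval g (suc N) x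
  eval-mulLin a g x zero    =
    solve 4 (λ a g₀ o x → con (+ 0) :+ (:- (a :* g₀)) :* o := x :* con (+ 0) :- a :* (con (+ 0) :+ g₀ :* o))
          refl a (g 0) 1# x
  eval-mulLin a g x (suc N) = trans (+-congʳ (eval-mulLin a g x N))
    (solve 7 (λ x e e′ gN gN′ a xN → (x :* e :- a :* e′) :+ (gN :- a :* gN′) :* (x :* xN)
                                    := x :* (e :+ gN :* xN) :- a :* (e′ :+ gN′ :* (x :* xN)))
           refl x (eval g N x) (eval g (suc N) x) (g N) (g (suc N)) a (powK R x N))

  eval-rootPoly : ∀ {n} (xs : Fin (suc n) → Carrier) x →
                  eval (rootPoly R xs) (suc (suc n)) x ≈ (x - xs fzero) * eval (rootPoly R (xs ∘ fsuc)) (suc n) x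
  eval-rootPoly {n} xs x = begin
    eval (mulLin R a g) (suc (suc n)) x         ≈⟨ eval-mulLin a g x (suc n) ⟩
    x * eval g (suc n) x - a * eval g (2 ℕ.+ n) x
                                                ≈⟨ +-congˡ (-‿cong (*-congˡ (Σ-last-zero (suc n) _ top≈0))) ⟩
    x * eval g (suc n) x - a * eval g (suc n) x ≈⟨ solve 3 (λ x a e → x :* e :- a :* e := (x :- a) :* e) refl x a _ ⟩
    (x - a) * eval g (suc n) x                  ∎
    where
    a = xs fzero
    g = rootPoly R (xs ∘ fsuc)
    top≈0 : g (suc n) * powK R x (suc n) ≈ 0#
    top≈0 = trans (*-congʳ (rootPoly-high _ (suc n) ℕ.≤-refl)) (zeroˡ _)

  eval-rootPoly-root : ∀ {n} (xs : Fin n → Carrier) i → eval (rootPoly R xs) (suc n) (xs i) ≈ 0#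
  eval-rootPoly-root {suc n} xs fzero    =
    trans (eval-rootPoly xs (xs fzero)) (trans (*-congʳ (-‿inverseʳ _)) (zeroˡ _))
  eval-rootPoly-root {suc n} xs (fsuc i) =
    trans (eval-rootPoly xs (xs (fsuc i))) (trans (*-congˡ (eval-rootPoly-root (xs ∘ fsuc) i)) (zeroʳ _))

  Σ-telescope : ∀ (v : ℕ → Carrier) a m →
                Σ m (λ r → (v r - a * v (suc r)) * powK R a r) ≈ v 0 - powK R a m * v m
  Σ-telescope v a zero    = sym (trans (+-congˡ (-‿cong (*-identityˡ _))) (-‿inverseʳ _))
  Σ-telescope v a (suc m) = trans (+-congʳ (Σ-telescope v a m))
    (solve 5 (λ v₀ am vm a vm′ → (v₀ :- am :* vm) :+ (vm :- a :* vm′) :* am := v₀ :- (a :* am) :* vm′)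
           refl (v 0) (powK R a m) (v m) a (v (suc m)))

  private
    ×-zeroʳ : ∀ n → n × 0# ≈ 0#
    ×-zeroʳ zero    = refl
    ×-zeroʳ (suc n) = trans (+-identityˡ _) (×-zeroʳ n)

    ×-distrib-−* : ∀ n x a y → n × (x - a * y) ≈ n × x - a * (n × y)
    ×-distrib-−* n x a y = trans (×-distrib-+ x _ n) (+-congˡ (begin
      n × (- (a * y))     ≈⟨ ×-congʳ n (-‿distribˡ-* a y) ⟩
      n × (- a * y)       ≈⟨ ×-comm-* n (- a) y ⟨
      - a * (n × y)       ≈⟨ -‿distribˡ-* a (n × y) ⟨
      - (a * (n × y))     ∎))

  -- rootPoly xs d is the coefficient of X^d in C = Π (X - x_i); the identity compares the
  -- coefficients of X^(d-1) in C′ = Σ_i C / (X - x_i).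
  NewtonIdentity : ∀ {n} → (Fin n → Carrier) → ℕ → Set
  NewtonIdentity {n} xs d = d × rootPoly R xs d ≈ Σ (suc n) (λ r → rootPoly R xs (d ℕ.+ r) * powerSum xs r)

  private
    module NewtonStep {n} (xs : Fin (suc n) → Carrier) (ih : ∀ d → NewtonIdentity (xs ∘ fsuc) d) where
      a  = xs fzero
      g  = rootPoly R (xs ∘ fsuc)
      c  = rootPoly R xs
      p′ = powerSum (xs ∘ fsuc)

      g-high : ∀ {m} → suc n ≤ m → g m ≈ 0#
      g-high = rootPoly-high _ _

      at-0 : Σ (2 ℕ.+ n) (λ r → c r * powK R a r) + Σ (2 ℕ.+ n) (λ r → c r * p′ r) ≈ 0 × c 0
      at-0 = begin
        eval c (2 ℕ.+ n) a + Σ (2 ℕ.+ n) (λ r → c r * p′ r)      ≈⟨ +-congʳ (eval-rootPoly-root xs fzero) ⟩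
        0# + Σ (2 ℕ.+ n) (λ r → c r * p′ r)                      ≈⟨ +-identityˡ _ ⟩
        Σ (2 ℕ.+ n) (λ r → c r * p′ r)                           ≈⟨ Σ-cong (2 ℕ.+ n) (λ r _ → *-distribˡ-ΣF n (c r) _) ⟩
        Σ (2 ℕ.+ n) (λ r → ΣF (λ i → c r * powK R (xs (fsuc i)) r)) ≈⟨ ΣF-Σ-comm n (2 ℕ.+ n) _ ⟨
        ΣF (λ i → eval c (2 ℕ.+ n) (xs (fsuc i)))                  ≈⟨ ΣF-cong n (λ i → eval-rootPoly-root xs (fsuc i)) ⟩
        ΣF {n} (λ _ → 0#)                                        ≈⟨ ΣF-zero n ⟩
        0#                                                       ∎

      telescoped : ∀ d → Σ (2 ℕ.+ n) (λ r → c (suc d ℕ.+ r) * powK R a r) ≈ g d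
      telescoped d = begin
        Σ (2 ℕ.+ n) (λ r → c (suc d ℕ.+ r) * powK R a r)
          ≈⟨ Σ-cong (2 ℕ.+ n) (λ r _ → *-congʳ (+-congˡ (-‿cong (*-congˡ (reflexive (≡.cong g (≡.sym (ℕ.+-suc d r)))))))) ⟩
        Σ (2 ℕ.+ n) (λ r → (v r - a * v (suc r)) * powK R a r)  ≈⟨ Σ-telescope v a (2 ℕ.+ n) ⟩
        v 0 - powK R a (2 ℕ.+ n) * v (2 ℕ.+ n)
          ≈⟨ +-cong (reflexive (≡.cong g (ℕ.+-identityʳ d)))
                    (-‿cong (trans (*-congˡ (g-high (ℕ.≤-trans (ℕ.n≤1+n _) (ℕ.m≤n+m _ d)))) (zeroʳ _))) ⟩
        g d - 0#                                                 ≈⟨ trans (+-congˡ -0#≈0#) (+-identityʳ _) ⟩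
        g d                                                      ∎
        where
        v : ℕ → Carrier
        v r = g (d ℕ.+ r)

      shortened : ∀ e → Σ (2 ℕ.+ n) (λ r → g (e ℕ.+ r) * p′ r) ≈ e × g e
      shortened e = trans (Σ-last-zero (suc n) _ (trans (*-congʳ (g-high (ℕ.m≤n+m _ e))) (zeroˡ _))) (sym (ih e))

      at-suc : ∀ d → Σ (2 ℕ.+ n) (λ r → c (suc d ℕ.+ r) * powK R a r) + Σ (2 ℕ.+ n) (λ r → c (suc d ℕ.+ r) * p′ r)
                     ≈ suc d × c (suc d)
      at-suc d = begin
        Σ (2 ℕ.+ n) (λ r → c (suc d ℕ.+ r) * powK R a r) + Σ (2 ℕ.+ n) (λ r → c (suc d ℕ.+ r) * p′ r)
          ≈⟨ +-congʳ (telescoped d) ⟩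
        g d + Σ (2 ℕ.+ n) (λ r → (g (d ℕ.+ r) - a * g (suc d ℕ.+ r)) * p′ r)
          ≈⟨ +-congˡ (Σ-cong (2 ℕ.+ n) (λ r _ →
               solve 4 (λ x a y p → (x :- a :* y) :* p := x :* p :- a :* (y :* p)) refl _ a _ _)) ⟩
        g d + Σ (2 ℕ.+ n) (λ r → g (d ℕ.+ r) * p′ r - a * (g (suc d ℕ.+ r) * p′ r))
          ≈⟨ +-congˡ (trans (Σ-distrib-- (2 ℕ.+ n) _ _) (+-congˡ (-‿cong (sym (*-distribˡ-Σ (2 ℕ.+ n) a _))))) ⟩
        g d + (Σ (2 ℕ.+ n) (λ r → g (d ℕ.+ r) * p′ r) - a * Σ (2 ℕ.+ n) (λ r → g (suc d ℕ.+ r) * p′ r))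
          ≈⟨ +-congˡ (+-cong (shortened d) (-‿cong (*-congˡ (shortened (suc d))))) ⟩
        g d + (d × g d - a * (suc d × g (suc d)))
          ≈⟨ solve 5 (λ G X a G′ Y → G :+ (X :- a :* (G′ :+ Y)) := (G :- a :* G′) :+ (X :- a :* Y))
                   refl (g d) (d × g d) a (g (suc d)) (d × g (suc d)) ⟩
        (g d - a * g (suc d)) + (d × g d - a * (d × g (suc d)))
          ≈⟨ +-congˡ (×-distrib-−* d (g d) a (g (suc d))) ⟨
        suc d × c (suc d)                                        ∎

  newton : ∀ {n} (xs : Fin n → Carrier) d → NewtonIdentity xs d
  newton {zero} xs d = trans (lhs≈0 d) (sym (trans (+-identityˡ _) (zeroʳ _)))
    where
    lhs≈0 : ∀ d → d × rootPoly R xs d ≈ 0#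
    lhs≈0 zero    = refl
    lhs≈0 (suc d) = trans (+-identityˡ _) (×-zeroʳ d)
  newton {suc n} xs d = sym (begin
    Σ (2 ℕ.+ n) (λ r → c (d ℕ.+ r) * (powK R a r + p′ r))
      ≈⟨ Σ-cong (2 ℕ.+ n) (λ r _ → distribˡ _ _ _) ⟩
    Σ (2 ℕ.+ n) (λ r → c (d ℕ.+ r) * powK R a r + c (d ℕ.+ r) * p′ r)
      ≈⟨ Σ-distrib-+ (2 ℕ.+ n) _ _ ⟩
    Σ (2 ℕ.+ n) (λ r → c (d ℕ.+ r) * powK R a r) + Σ (2 ℕ.+ n) (λ r → c (d ℕ.+ r) * p′ r)
      ≈⟨ split d ⟩
    d × c d                                                      ∎)
    where
    open NewtonStep xs (newton (xs ∘ fsuc))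
    split : ∀ d → Σ (2 ℕ.+ n) (λ r → c (d ℕ.+ r) * powK R a r) + Σ (2 ℕ.+ n) (λ r → c (d ℕ.+ r) * p′ r) ≈ d × c d
    split zero    = at-0
    split (suc d) = at-suc d

  Σ-tails : ∀ K (g : ℕ → Carrier) → (∀ v → K < v → g v ≈ 0#) →
            Σ K (λ i → Σ (suc K) (λ e → g (e ℕ.+ suc i))) ≈ Σ (suc K) (λ v → v × g v)
  Σ-tails K g g-high = begin
    Σ K (λ i → tail (suc i))                                 ≈⟨ partial K ⟩
    Σ (suc K) (λ v → v × g v) + K × tail (suc K)             ≈⟨ +-congˡ (trans (×-congʳ K tail-high) (×-zeroʳ K)) ⟩
    Σ (suc K) (λ v → v × g v) + 0#                           ≈⟨ +-identityʳ _ ⟩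
    Σ (suc K) (λ v → v × g v)                                ∎
    where
    tail : ℕ → Carrier
    tail m = Σ (suc K) (λ e → g (e ℕ.+ m))

    tail-suc : ∀ m → tail m ≈ g m + tail (suc m)
    tail-suc m = trans (Σ-head K _) (+-congˡ (sym (trans
      (Σ-last-zero K _ (g-high _ (ℕ.m<m+n K (s≤s z≤n))))
      (Σ-cong K (λ e _ → reflexive (≡.cong g (ℕ.+-suc e m)))))))

    tail-high : tail (suc K) ≈ 0#
    tail-high = Σ-zero (suc K) (λ e _ → g-high _ (ℕ.m≤n+m (suc K) e))

    partial : ∀ M → Σ M (λ i → tail (suc i)) ≈ Σ (suc M) (λ v → v × g v) + M × tail (suc M)
    partial zero    = sym (trans (+-identityʳ _) (+-identityˡ _))
    partial (suc M) = begin
      Σ M (λ i → tail (suc i)) + tail (suc M)                   ≈⟨ +-cong (partial M) (tail-suc (suc M)) ⟩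
      (W + M × tail (suc M)) + (G + T)                          ≈⟨ +-congʳ (+-congˡ (×-congʳ M (tail-suc (suc M)))) ⟩
      (W + M × (G + T)) + (G + T)                               ≈⟨ +-congʳ (+-congˡ (×-distrib-+ G T M)) ⟩
      (W + (M × G + M × T)) + (G + T)
        ≈⟨ solve 5 (λ S MG MT G T → (S :+ (MG :+ MT)) :+ (G :+ T) := (S :+ (G :+ MG)) :+ (T :+ MT))
                 refl W (M × G) (M × T) G T ⟩
      (W + suc M × G) + suc M × T                               ∎
      where
      W = Σ (suc M) (λ v → v × g v)
      G = g (suc M)
      T = tail (2 ℕ.+ M)

module Transport (R S : CommutativeRing 0ℓ 0ℓ) (φ : CommutativeRing.Carrier R → CommutativeRing.Carrier S)
                 (φ-hom : IsRingHomomorphism (CommutativeRing.rawRing R) (CommutativeRing.rawRing S) φ) where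
  open CommutativeRing S
  open IsRingHomomorphism φ-hom
  private
    module R = CommutativeRing R
    module ΣR = Sums R
    module LR = LinearRecurrences R
  open Sums S
  open LinearRecurrences S

  φ-Σ : ∀ n f → φ (ΣR.Σ n f) ≈ Σ n (φ ∘ f)
  φ-Σ zero    f = 0#-homo
  φ-Σ (suc n) f = trans (+-homo _ _) (+-congʳ (φ-Σ n f))

  φ-LinRec : ∀ {k c x} → LR.LinRec k c x → LinRec k (φ ∘ c) (φ ∘ x)
  φ-LinRec {k} rx = linRec λ n → trans (⟦⟧-cong (LR.recur rx n)) (trans (φ-Σ k _) (Σ-cong k (λ l _ → *-homo _ _)))

  φ-Ccoef : ∀ k (t : Fin k → ℤ) (ι : ℚ → R.Carrier) d → φ (Ccoef R k t ι d) ≈ Ccoef S k t (φ ∘ ι) d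
  φ-Ccoef k t ι d with does (d ℕ.≟ k)
  ... | true  = 1#-homo
  ... | false = -‿homo _

ℚ-ring : CommutativeRing 0ℓ 0ℓ
ℚ-ring = ℚ.+-*-commutativeRing

δ : ℕ → ℕ → ℚ
δ i j = if does (i ℕ.≟ j) then 1ℚ else 0ℚ

δ-refl : ∀ i → δ i i ≡ 1ℚ
δ-refl i = ≡.cong (λ b → if b then 1ℚ else 0ℚ) (dec-true (i ℕ.≟ i) ≡.refl)

δ-≢ : ∀ {i j} → i ≢ j → δ i j ≡ 0ℚ
δ-≢ {i} {j} i≢j = ≡.cong (λ b → if b then 1ℚ else 0ℚ) (dec-false (i ℕ.≟ j) i≢j)

module _ (K : CommutativeRing 0ℓ 0ℓ) (k : ℕ) (t : Fin k → ℤ) (ι : ℚ → CommutativeRing.Carrier K) where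
  open CommutativeRing K using (1#; -_)

  private
    Ccoef-if : ∀ d {b} → does (d ℕ.≟ k) ≡ b → Ccoef K k t ι d ≡ (if b then 1# else - ι (tq t (k ∸ d)))
    Ccoef-if d = ≡.cong (λ b → if b then 1# else - ι (tq t (k ∸ d)))

  Ccoef-top : Ccoef K k t ι k ≡ 1#
  Ccoef-top = Ccoef-if k (dec-true (k ℕ.≟ k) ≡.refl)

  Ccoef-below : ∀ {d} → d < k → Ccoef K k t ι d ≡ - ι (tq t (k ∸ d))
  Ccoef-below {d} d<k = Ccoef-if d (dec-false (d ℕ.≟ k) (ℕ.<⇒≢ d<k))

  Ccoef-above : ∀ {d} → k < d → Ccoef K k t ι d ≡ - ι (tq t 0)
  Ccoef-above {d} k<d = ≡.trans (Ccoef-if d (dec-false (d ℕ.≟ k) (ℕ.>⇒≢ k<d)))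
                                (≡.cong (λ m → - ι (tq t m)) (ℕ.m≤n⇒m∸n≡0 (ℕ.<⇒≤ k<d)))

module Hooks (k′ : ℕ) (t : Fin (suc k′) → ℤ) (h : ℤ → ℚ) (h-fib : IsGenFib (suc k′) t h) where
  open Sums ℚ-ring
  open LinearRecurrences ℚ-ring
  open import Data.Rational.Solver using (module +-*-Solver)
  open +-*-Solver using (solve; _:+_; _:*_; _:-_; :-_; _:=_; con)
  open ≡.≡-Reasoning

  k : ℕ
  k = suc k′

  c : ℕ → ℚ
  c l = tq t (suc l)

  h-LinRec : LinRec k c h
  h-LinRec = linRec (proj₂ (proj₂ h-fib))

  h-window : ∀ m → 1 ≤ m → m < k → h (ℤ.- + m) ≡ 0ℚ
  h-window = proj₁ (proj₂ h-fib)

  sgn² : ∀ b → sgn b ℚ.* sgn b ≡ 1ℚ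
  sgn² zero    = ≡.refl
  sgn² (suc b) = ≡.trans (solve 1 (λ s → (:- s) :* (:- s) := s :* s) ≡.refl (sgn b)) (sgn² b)

  hook : ℕ → ℤ → ℚ
  hook b a = sgn b ℚ.* S t h a b

  private
    a+[1+i]≡[a+1]+i : ∀ a i → a ℤ.+ (+ 1 ℤ.+ i) ≡ (a ℤ.+ + 1) ℤ.+ i
    a+[1+i]≡[a+1]+i = solve-∀

  S-suc : ∀ a b → S t h a (suc b) ≡ h a ℚ.* e t (suc b) ℚ.- S t h (a ℤ.+ + 1) b
  S-suc a b = begin
    S t h a (suc b)                                          ≡⟨ Σ-head (suc b) _ ⟩
    (1ℚ ℚ.* h (a ℤ.+ + 0)) ℚ.* e t (suc b) ℚ.+ Σ (suc b) later
      ≡⟨ ≡.cong₂ ℚ._+_ (≡.cong (λ z → (1ℚ ℚ.* h z) ℚ.* e t (suc b)) (ℤ.+-identityʳ a)) (Σ-cong (suc b) (λ i _ → later≡ i)) ⟩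
    (1ℚ ℚ.* h a) ℚ.* e t (suc b) ℚ.+ Σ (suc b) (λ i → ℚ.- ((sgn i ℚ.* h ((a ℤ.+ + 1) ℤ.+ + i)) ℚ.* e t (b ∸ i)))
      ≡⟨ ≡.cong₂ ℚ._+_ (≡.cong (ℚ._* e t (suc b)) (ℚ.*-identityˡ (h a))) (Σ-neg (suc b) _) ⟩
    h a ℚ.* e t (suc b) ℚ.- S t h (a ℤ.+ + 1) b              ∎
    where
    later : ℕ → ℚ
    later i = (sgn (suc i) ℚ.* h (a ℤ.+ + suc i)) ℚ.* e t (b ∸ i)
    later≡ : ∀ i → later i ≡ ℚ.- ((sgn i ℚ.* h ((a ℤ.+ + 1) ℤ.+ + i)) ℚ.* e t (b ∸ i))
    later≡ i = ≡.trans (≡.cong (λ z → (sgn (suc i) ℚ.* h z) ℚ.* e t (b ∸ i)) (a+[1+i]≡[a+1]+i a (+ i)))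
                       (solve 3 (λ s x y → ((:- s) :* x) :* y := :- ((s :* x) :* y)) ≡.refl (sgn i) (h ((a ℤ.+ + 1) ℤ.+ + i)) (e t (b ∸ i)))

  hook-zero : ∀ a → hook 0 a ≡ h a
  hook-zero a = ≡.trans (solve 1 (λ x → con 1ℚ :* (con 0ℚ :+ (con 1ℚ :* x) :* con 1ℚ) := x) ≡.refl _)
                        (≡.cong h (ℤ.+-identityʳ a))

  hook-suc : ∀ b a → hook (suc b) a ≡ hook b (a ℤ.+ + 1) ℚ.- c b ℚ.* h a
  hook-suc b a = begin
    ℚ.- sgn b ℚ.* S t h a (suc b)                                  ≡⟨ ≡.cong (ℚ.- sgn b ℚ.*_) (S-suc a b) ⟩
    ℚ.- sgn b ℚ.* (h a ℚ.* (sgn b ℚ.* c b) ℚ.- S t h (a ℤ.+ + 1) b)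
      ≡⟨ solve 4 (λ s x y z → (:- s) :* (x :* (s :* y) :- z) := s :* z :- (s :* s) :* (y :* x)) ≡.refl (sgn b) (h a) (c b) (S t h (a ℤ.+ + 1) b) ⟩
    hook b (a ℤ.+ + 1) ℚ.- (sgn b ℚ.* sgn b) ℚ.* (c b ℚ.* h a)   ≡⟨ ≡.cong (λ z → hook b (a ℤ.+ + 1) ℚ.- z ℚ.* (c b ℚ.* h a)) (sgn² b) ⟩
    hook b (a ℤ.+ + 1) ℚ.- 1ℚ ℚ.* (c b ℚ.* h a)                   ≡⟨ ≡.cong (λ z → hook b (a ℤ.+ + 1) ℚ.- z) (ℚ.*-identityˡ _) ⟩
    hook b (a ℤ.+ + 1) ℚ.- c b ℚ.* h a                             ∎

  hook-LinRec : ∀ b → LinRec k c (hook b)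
  hook-LinRec zero    = LinRec-resp (≡.sym ∘ hook-zero) h-LinRec
  hook-LinRec (suc b) = LinRec-resp (≡.sym ∘ hook-suc b)
    (LinRec-− (LinRec-shift (+ 1) (hook-LinRec b)) (LinRec-* (c b) h-LinRec))

  private
    [a+1]+b≡a+[1+b] : ∀ a b → (a ℤ.+ + 1) ℤ.+ b ≡ a ℤ.+ (+ 1 ℤ.+ b)
    [a+1]+b≡a+[1+b] = solve-∀
    a+[1+b]-[1+b]≡a : ∀ a b → a ℤ.+ (+ 1 ℤ.+ b) ℤ.- (+ 1 ℤ.+ b) ≡ a
    a+[1+b]-[1+b]≡a = solve-∀

  hook-unfold : ∀ b a → hook b a ≡ h (a ℤ.+ + b) ℚ.- Σ b (λ s → c s ℚ.* h (a ℤ.+ + b ℤ.- + suc s))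
  hook-unfold zero    a = ≡.trans (hook-zero a) (≡.trans (≡.cong h (≡.sym (ℤ.+-identityʳ a))) (≡.sym (ℚ.+-identityʳ _)))
  hook-unfold (suc b) a = begin
    hook (suc b) a                                                        ≡⟨ hook-suc b a ⟩
    hook b (a ℤ.+ + 1) ℚ.- c b ℚ.* h a                                    ≡⟨ ≡.cong₂ (λ x y → x ℚ.- c b ℚ.* h y)
                                                                               (≡.trans (hook-unfold b (a ℤ.+ + 1)) (≡.cong unfolded ([a+1]+b≡a+[1+b] a (+ b))))
                                                                               (≡.sym (a+[1+b]-[1+b]≡a a (+ b))) ⟩
    unfolded (a ℤ.+ + suc b) ℚ.- c b ℚ.* h (a ℤ.+ + suc b ℤ.- + suc b)
      ≡⟨ solve 3 (λ x y z → (x :- y) :- z := x :- (y :+ z)) ≡.refl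
               (h (a ℤ.+ + suc b)) (Σ b (λ s → c s ℚ.* h (a ℤ.+ + suc b ℤ.- + suc s))) (c b ℚ.* h (a ℤ.+ + suc b ℤ.- + suc b)) ⟩
    h (a ℤ.+ + suc b) ℚ.- Σ (suc b) (λ s → c s ℚ.* h (a ℤ.+ + suc b ℤ.- + suc s))  ∎
    where
    unfolded : ℤ → ℚ
    unfolded z = h z ℚ.- Σ b (λ s → c s ℚ.* h (z ℤ.- + suc s))

  hook-k : ∀ a → hook k a ≡ 0ℚ
  hook-k a = ≡.trans (hook-unfold k a) (≡.trans (≡.cong (ℚ._- R) (recur h-LinRec (a ℤ.+ + k))) (ℚ.+-inverseʳ R))
    where R = Σ k (λ s → c s ℚ.* h (a ℤ.+ + k ℤ.- + suc s))

  entry : ℤ → ℕ → ℕ → ℚ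
  entry n i j = hook (k ∸ suc j) (n ℤ.- + k ℤ.+ + suc i)

  private
    n+[-k+i]≡n-k+i : ∀ n k i → n ℤ.+ (ℤ.- k ℤ.+ i) ≡ n ℤ.- k ℤ.+ i
    n+[-k+i]≡n-k+i = solve-∀
    [n+1]-k+i≡n-k+[1+i] : ∀ n k i → (n ℤ.+ + 1) ℤ.- k ℤ.+ i ≡ n ℤ.- k ℤ.+ (+ 1 ℤ.+ i)
    [n+1]-k+i≡n-k+[1+i] = solve-∀
    n-k+k≡n : ∀ n k → n ℤ.- k ℤ.+ k ≡ n
    n-k+k≡n = solve-∀
    [n+1]-[k-l]≡n-k+[1+l] : ∀ n k l → (n ℤ.+ + 1) ℤ.- (k ℤ.- l) ≡ n ℤ.- k ℤ.+ (+ 1 ℤ.+ l)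
    [n+1]-[k-l]≡n-k+[1+l] = solve-∀

  entry-LinRec : ∀ i j → LinRec k c (λ n → entry n i j)
  entry-LinRec i j = LinRec-resp (λ n → ≡.cong (hook (k ∸ suc j)) (n+[-k+i]≡n-k+i n (+ k) (+ suc i)))
                                 (LinRec-shift (ℤ.- + k ℤ.+ + suc i) (hook-LinRec (k ∸ suc j)))

  entry-shift : ∀ n i j → entry (n ℤ.+ + 1) i j ≡ entry n (suc i) j
  entry-shift n i j = ≡.cong (hook (k ∸ suc j)) ([n+1]-k+i≡n-k+[1+i] n (+ k) (+ suc i))

  entry-last : ∀ n j → entry (n ℤ.+ + 1) k′ j ≡ Σ k (λ l → tq t (k ∸ l) ℚ.* entry n l j)
  entry-last n j = begin
    hook b ((n ℤ.+ + 1) ℤ.- + k ℤ.+ + k)                       ≡⟨ ≡.cong (hook b) (n-k+k≡n (n ℤ.+ + 1) (+ k)) ⟩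
    hook b (n ℤ.+ + 1)                                          ≡⟨ recur (hook-LinRec b) (n ℤ.+ + 1) ⟩
    Σ k (λ s → c s ℚ.* hook b (n ℤ.+ + 1 ℤ.- + suc s))         ≡⟨ Σ-reverse k _ ⟨
    Σ k (λ l → c (k ∸ suc l) ℚ.* hook b (n ℤ.+ + 1 ℤ.- + suc (k ∸ suc l)))
      ≡⟨ Σ-cong k (λ l l<k → ≡.trans (≡.cong (λ m → tq t m ℚ.* hook b (n ℤ.+ + 1 ℤ.- + m)) (≡.sym (ℕ.+-∸-assoc 1 l<k)))
                                      (≡.cong (λ z → tq t (k ∸ l) ℚ.* hook b z) (reindex l l<k))) ⟩
    Σ k (λ l → tq t (k ∸ l) ℚ.* entry n l j)                   ∎
    where
    b = k ∸ suc j
    reindex : ∀ l → l < k → n ℤ.+ + 1 ℤ.- + (k ∸ l) ≡ n ℤ.- + k ℤ.+ + suc l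
    reindex l l<k = ≡.trans (≡.cong (λ z → n ℤ.+ + 1 ℤ.- z) (+[m∸n]≡m-n k l (ℕ.<⇒≤ l<k))) ([n+1]-[k-l]≡n-k+[1+l] n (+ k) (+ l))

  entry-corner : ∀ n → entry n k′ k′ ≡ h n
  entry-corner n = ≡.trans (≡.cong₂ hook (ℕ.n∸n≡0 k′) (n-k+k≡n n (+ k))) (hook-zero n)

  private
    h-vanishes : ∀ {z} m → z ≡ ℤ.- + m → 1 ≤ m → m < k → h z ≡ 0ℚ
    h-vanishes m ≡.refl = h-window m

    [0-k+1]+[k-[1+j]]≡-j : ∀ k j → (+ 0 ℤ.- k ℤ.+ + 1) ℤ.+ (k ℤ.- (+ 1 ℤ.+ j)) ≡ ℤ.- j
    [0-k+1]+[k-[1+j]]≡-j = solve-∀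
    -j-s≡-[j+s] : ∀ j s → ℤ.- j ℤ.- s ≡ ℤ.- (j ℤ.+ s)
    -j-s≡-[j+s] = solve-∀
    [0-[1+k]+[1+i]]+k≡i : ∀ k i → (+ 0 ℤ.- (+ 1 ℤ.+ k) ℤ.+ (+ 1 ℤ.+ i)) ℤ.+ k ≡ i
    [0-[1+k]+[1+i]]+k≡i = solve-∀
    i-k≡-[k-i] : ∀ i k → i ℤ.- k ≡ ℤ.- (k ℤ.- i)
    i-k≡-[k-i] = solve-∀
    [0-k+[1+i]]+1≡0-k+[2+i] : ∀ k i → (+ 0 ℤ.- k ℤ.+ (+ 1 ℤ.+ i)) ℤ.+ + 1 ≡ + 0 ℤ.- k ℤ.+ (+ 1 ℤ.+ (+ 1 ℤ.+ i))
    [0-k+[1+i]]+1≡0-k+[2+i] = solve-∀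
    0-k+[1+i]≡-[k-[1+i]] : ∀ k i → + 0 ℤ.- k ℤ.+ (+ 1 ℤ.+ i) ≡ ℤ.- (k ℤ.- (+ 1 ℤ.+ i))
    0-k+[1+i]≡-[k-[1+i]] = solve-∀

  entry₀-row : ∀ j → j < k → entry (+ 0) 0 j ≡ δ 0 j
  entry₀-row j j<k = begin
    hook b a                                                         ≡⟨ hook-unfold b a ⟩
    h (a ℤ.+ + b) ℚ.- Σ b (λ s → c s ℚ.* h (a ℤ.+ + b ℤ.- + suc s))  ≡⟨ ≡.cong (λ z → h z ℚ.- Σ b (λ s → c s ℚ.* h (z ℤ.- + suc s))) a+b≡-j ⟩
    h (ℤ.- + j) ℚ.- Σ b (λ s → c s ℚ.* h (ℤ.- + j ℤ.- + suc s))      ≡⟨ ≡.cong (λ z → h (ℤ.- + j) ℚ.- z) (Σ-zero b below-window) ⟩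
    h (ℤ.- + j) ℚ.- 0ℚ                                               ≡⟨ ℚ.+-identityʳ _ ⟩
    h (ℤ.- + j)                                                      ≡⟨ at j j<k ⟩
    δ 0 j                                                            ∎
    where
    a = + 0 ℤ.- + k ℤ.+ + 1
    b = k ∸ suc j
    a+b≡-j : a ℤ.+ + b ≡ ℤ.- + j
    a+b≡-j = ≡.trans (≡.cong (λ z → a ℤ.+ z) (+[m∸n]≡m-n k (suc j) j<k)) ([0-k+1]+[k-[1+j]]≡-j (+ k) (+ j))
    below-window : ∀ s → s < b → c s ℚ.* h (ℤ.- + j ℤ.- + suc s) ≡ 0ℚ
    below-window s s<b = ≡.trans (≡.cong (c s ℚ.*_)
        (h-vanishes (j ℕ.+ suc s) (≡.trans (-j-s≡-[j+s] (+ j) (+ suc s)) (≡.cong ℤ.-_ (≡.sym (ℤ.pos-+ j (suc s)))))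
                    (ℕ.≤-trans (s≤s z≤n) (ℕ.m≤n+m (suc s) j)) (ℕ.≤-trans (ℕ.≤-reflexive (ℕ.+-comm (suc j) (suc s))) (ℕ.m≤o∸n⇒m+n≤o (suc s) j<k s<b))))
      (ℚ.*-zeroʳ (c s))
    at : ∀ j → j < k → h (ℤ.- + j) ≡ δ 0 j
    at zero    _     = proj₁ h-fib
    at (suc j) 1+j<k = h-window (suc j) (s≤s z≤n) 1+j<k

  entry₀-column : ∀ i → i < k → entry (+ 0) i 0 ≡ δ i 0
  entry₀-column i i<k = begin
    hook k′ a                                                            ≡⟨ hook-unfold k′ a ⟩
    h (a ℤ.+ + k′) ℚ.- Σ k′ (λ s → c s ℚ.* h (a ℤ.+ + k′ ℤ.- + suc s))   ≡⟨ ≡.cong (λ z → h z ℚ.- Σ k′ (λ s → c s ℚ.* h (z ℤ.- + suc s)))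
                                                                              ([0-[1+k]+[1+i]]+k≡i (+ k′) (+ i)) ⟩
    h (+ i) ℚ.- Σ k′ (λ s → c s ℚ.* h (+ i ℤ.- + suc s))                 ≡⟨ at i i<k ⟩
    δ i 0                                                                ∎
    where
    a = + 0 ℤ.- + k ℤ.+ + suc i
    at : ∀ i → i < k → h (+ i) ℚ.- Σ k′ (λ s → c s ℚ.* h (+ i ℤ.- + suc s)) ≡ δ i 0
    at zero _ = ≡.cong₂ ℚ._-_ (proj₁ h-fib)
      (Σ-zero k′ (λ s s<k′ → ≡.trans (≡.cong (c s ℚ.*_) (h-window (suc s) (s≤s z≤n) (s≤s s<k′))) (ℚ.*-zeroʳ (c s))))
    at (suc i) 1+i<k = begin
      h (+ suc i) ℚ.- R                                    ≡⟨ ≡.cong (ℚ._- R) (recur h-LinRec (+ suc i)) ⟩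
      (R ℚ.+ c k′ ℚ.* h (+ suc i ℤ.- + k)) ℚ.- R           ≡⟨ ≡.cong (λ z → (R ℚ.+ c k′ ℚ.* z) ℚ.- R) last-vanishes ⟩
      (R ℚ.+ c k′ ℚ.* 0ℚ) ℚ.- R                            ≡⟨ solve 2 (λ x y → (x :+ y :* con 0ℚ) :- x := con 0ℚ) ≡.refl R (c k′) ⟩
      0ℚ                                                   ∎
      where
      R = Σ k′ (λ s → c s ℚ.* h (+ suc i ℤ.- + suc s))
      last-vanishes : h (+ suc i ℤ.- + k) ≡ 0ℚ
      last-vanishes = h-vanishes (k ∸ suc i)
        (≡.trans (i-k≡-[k-i] (+ suc i) (+ k)) (≡.cong ℤ.-_ (≡.sym (+[m∸n]≡m-n k (suc i) (ℕ.<⇒≤ 1+i<k)))))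
        (ℕ.m<n⇒0<n∸m 1+i<k) (s≤s (ℕ.m∸n≤m k′ i))

  entry₀-diagonal-step : ∀ i j → suc i < k → suc j < k → entry (+ 0) (suc i) (suc j) ≡ entry (+ 0) i j
  entry₀-diagonal-step i j 1+i<k 1+j<k = ≡.sym (begin
    hook (k ∸ suc j) a                                    ≡⟨ ≡.cong (λ m → hook m a) (ℕ.+-∸-assoc 1 1+j<k) ⟩
    hook (suc b) a                                        ≡⟨ hook-suc b a ⟩
    hook b (a ℤ.+ + 1) ℚ.- c b ℚ.* h a                    ≡⟨ ≡.cong₂ (λ x y → hook b x ℚ.- c b ℚ.* y)
                                                               ([0-k+[1+i]]+1≡0-k+[2+i] (+ k) (+ i)) h-a≡0 ⟩
    hook b (+ 0 ℤ.- + k ℤ.+ + suc (suc i)) ℚ.- c b ℚ.* 0ℚ ≡⟨ solve 2 (λ x y → x :- y :* con 0ℚ := x) ≡.refl (hook b (+ 0 ℤ.- + k ℤ.+ + suc (suc i))) (c b) ⟩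
    hook b (+ 0 ℤ.- + k ℤ.+ + suc (suc i))                ∎)
    where
    b = k ∸ suc (suc j)
    a = + 0 ℤ.- + k ℤ.+ + suc i
    h-a≡0 : h a ≡ 0ℚ
    h-a≡0 = h-vanishes (k ∸ suc i)
      (≡.trans (0-k+[1+i]≡-[k-[1+i]] (+ k) (+ i)) (≡.cong ℤ.-_ (≡.sym (+[m∸n]≡m-n k (suc i) (ℕ.<⇒≤ 1+i<k)))))
      (ℕ.m<n⇒0<n∸m 1+i<k) (s≤s (ℕ.m∸n≤m k′ i))

  entry-initial : ∀ i j → i < k → j < k → entry (+ 0) i j ≡ δ i j
  entry-initial zero    j       _     j<k   = entry₀-row j j<k
  entry-initial (suc i) zero    1+i<k _     = entry₀-column (suc i) 1+i<k
  entry-initial (suc i) (suc j) 1+i<k 1+j<k =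
    ≡.trans (entry₀-diagonal-step i j 1+i<k 1+j<k) (entry-initial i j (ℕ.<⇒≤ 1+i<k) (ℕ.<⇒≤ 1+j<k))

  C : ℕ → ℚ
  C = Ccoef ℚ-ring k t id

  C-k : C k ≡ 1ℚ
  C-k = Ccoef-top ℚ-ring k t id

  C-< : ∀ {d} → d < k → C d ≡ ℚ.- tq t (k ∸ d)
  C-< = Ccoef-below ℚ-ring k t id

  C-> : ∀ {d} → k < d → C d ≡ 0ℚ
  C-> = Ccoef-above ℚ-ring k t id

  private
    a+[1+e]≡[a+1]+e : ∀ a e → a ℤ.+ (+ 1 ℤ.+ e) ≡ (a ℤ.+ + 1) ℤ.+ e
    a+[1+e]≡[a+1]+e = solve-∀

  hook-convolution : ∀ b a → b ≤ k → hook b a ≡ Σ (suc k) (λ e → C (e ℕ.+ (k ∸ b)) ℚ.* h (a ℤ.+ + e))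
  hook-convolution zero a _ = ≡.sym (begin
    Σ (suc k) (λ e → C (e ℕ.+ k) ℚ.* h (a ℤ.+ + e))                    ≡⟨ Σ-head k _ ⟩
    C k ℚ.* h (a ℤ.+ + 0) ℚ.+ Σ k (λ e → C (suc e ℕ.+ k) ℚ.* h (a ℤ.+ + suc e))
      ≡⟨ ≡.cong₂ ℚ._+_ (≡.cong₂ ℚ._*_ C-k (≡.cong h (ℤ.+-identityʳ a)))
                       (Σ-zero k (λ e _ → ≡.trans (≡.cong (ℚ._* h (a ℤ.+ + suc e)) (C-> (s≤s (ℕ.m≤n+m k e)))) (ℚ.*-zeroˡ (h (a ℤ.+ + suc e))))) ⟩
    1ℚ ℚ.* h a ℚ.+ 0ℚ                                                  ≡⟨ solve 1 (λ x → con 1ℚ :* x :+ con 0ℚ := x) ≡.refl (h a) ⟩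
    h a                                                                ≡⟨ hook-zero a ⟨
    hook 0 a                                                           ∎)
  hook-convolution (suc b) a 1+b≤k = begin
    hook (suc b) a                                                     ≡⟨ hook-suc b a ⟩
    hook b (a ℤ.+ + 1) ℚ.- c b ℚ.* h a                                 ≡⟨ ≡.cong (ℚ._- c b ℚ.* h a) (hook-convolution b (a ℤ.+ + 1) (ℕ.<⇒≤ 1+b≤k)) ⟩
    (X ℚ.+ C (k ℕ.+ (k ∸ b)) ℚ.* h ((a ℤ.+ + 1) ℤ.+ + k)) ℚ.- c b ℚ.* h a
      ≡⟨ ≡.cong (λ z → (X ℚ.+ z ℚ.* h ((a ℤ.+ + 1) ℤ.+ + k)) ℚ.- c b ℚ.* h a) (C-> (ℕ.m<m+n k (ℕ.m<n⇒0<n∸m 1+b≤k))) ⟩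
    (X ℚ.+ 0ℚ ℚ.* h ((a ℤ.+ + 1) ℤ.+ + k)) ℚ.- c b ℚ.* h a
      ≡⟨ solve 4 (λ x y c h → (x :+ con 0ℚ :* y) :- c :* h := (:- c) :* h :+ x) ≡.refl X (h ((a ℤ.+ + 1) ℤ.+ + k)) (c b) (h a) ⟩
    (ℚ.- c b) ℚ.* h a ℚ.+ X
      ≡⟨ ≡.cong₂ ℚ._+_ (≡.cong₂ ℚ._*_ (≡.sym C-first) (≡.cong h (≡.sym (ℤ.+-identityʳ a))))
                       (Σ-cong k (λ e _ → ≡.cong₂ ℚ._*_ (≡.cong C (index e)) (≡.cong h (≡.sym (a+[1+e]≡[a+1]+e a (+ e)))))) ⟩
    C (k ∸ suc b) ℚ.* h (a ℤ.+ + 0) ℚ.+ Σ k (λ e → C (suc e ℕ.+ (k ∸ suc b)) ℚ.* h (a ℤ.+ + suc e))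
                                                                       ≡⟨ Σ-head k _ ⟨
    Σ (suc k) (λ e → C (e ℕ.+ (k ∸ suc b)) ℚ.* h (a ℤ.+ + e))          ∎
    where
    X = Σ k (λ e → C (e ℕ.+ (k ∸ b)) ℚ.* h ((a ℤ.+ + 1) ℤ.+ + e))
    C-first : C (k ∸ suc b) ≡ ℚ.- c b
    C-first = ≡.trans (C-< (s≤s (ℕ.m∸n≤m k′ b))) (≡.cong (λ m → ℚ.- tq t m) (ℕ.m∸[m∸n]≡n 1+b≤k))
    index : ∀ e → e ℕ.+ (k ∸ b) ≡ suc e ℕ.+ (k ∸ suc b)
    index e = ≡.trans (≡.cong (e ℕ.+_) (ℕ.+-∸-assoc 1 1+b≤k)) (ℕ.+-suc e (k ∸ suc b))

module Matrices where
  open Sums ℚ-ring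
  open ≡.≡-Reasoning

  ⊗-assoc : ∀ {n} (M N P : Mat n) i j → (M ⊗ (N ⊗ P)) i j ≡ ((M ⊗ N) ⊗ P) i j
  ⊗-assoc {n} M N P i j = begin
    ΣF (λ l → M i l ℚ.* ΣF (λ p → N l p ℚ.* P p j))       ≡⟨ ΣF-cong n (λ l → ≡.trans (*-distribˡ-ΣF n (M i l) _)
                                                               (ΣF-cong n (λ p → ≡.sym (ℚ.*-assoc (M i l) _ _)))) ⟩
    ΣF (λ l → ΣF (λ p → (M i l ℚ.* N l p) ℚ.* P p j))     ≡⟨ ΣF-comm n n _ ⟩
    ΣF (λ p → ΣF (λ l → (M i l ℚ.* N l p) ℚ.* P p j))     ≡⟨ ΣF-cong n (λ p → *-distribʳ-ΣF n (P p j) _) ⟨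
    ΣF (λ p → ΣF (λ l → M i l ℚ.* N l p) ℚ.* P p j)       ∎

  Id-select : ∀ {n} (i : Fin n) (x : Fin n → ℚ) → ΣF (λ p → Id i p ℚ.* x p) ≡ x i
  Id-select {suc n} fzero x = begin
    1ℚ ℚ.* x fzero ℚ.+ ΣF (λ p → 0ℚ ℚ.* x (fsuc p))     ≡⟨ ≡.cong₂ ℚ._+_ (ℚ.*-identityˡ (x fzero))
                                                             (≡.trans (ΣF-cong n (λ p → ℚ.*-zeroˡ (x (fsuc p)))) (ΣF-zero n)) ⟩
    x fzero ℚ.+ 0ℚ                                       ≡⟨ ℚ.+-identityʳ _ ⟩
    x fzero                                              ∎
  Id-select {suc n} (fsuc i) x = begin
    0ℚ ℚ.* x fzero ℚ.+ ΣF (λ p → Id i p ℚ.* x (fsuc p))  ≡⟨ ≡.cong (ℚ._+ ΣF (λ p → Id i p ℚ.* x (fsuc p))) (ℚ.*-zeroˡ (x fzero)) ⟩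
    0ℚ ℚ.+ ΣF (λ p → Id i p ℚ.* x (fsuc p))              ≡⟨ ℚ.+-identityˡ _ ⟩
    ΣF (λ p → Id i p ℚ.* x (fsuc p))                     ≡⟨ Id-select i (x ∘ fsuc) ⟩
    x (fsuc i)                                           ∎

  Id≡δ : ∀ {n} (i j : Fin n) → Id i j ≡ δ (toℕ i) (toℕ j)
  Id≡δ i j with i Fin.≟ j
  ... | yes ≡.refl = ≡.sym (δ-refl (toℕ i))
  ... | no i≢j     = ≡.sym (δ-≢ (i≢j ∘ Fin.toℕ-injective))

module CompanionPowers (k′ : ℕ) (t : Fin (suc k′) → ℤ) (h : ℤ → ℚ) (h-fib : IsGenFib (suc k′) t h) where
  open Hooks k′ t h h-fib
  open Sums ℚ-ring
  open LinearRecurrences ℚ-ring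
  open Matrices
  open ≡.≡-Reasoning

  A : Mat k
  A = companion k t

  hookMatrix : ℤ → Mat k
  hookMatrix n i j = entry n (toℕ i) (toℕ j)

  A-last-row : ∀ {i} l → suc (toℕ i) ≡ k → A i l ≡ tq t (k ∸ toℕ l)
  A-last-row {i} l last = ≡.cong (λ b → if b then tq t (k ∸ toℕ l) else δ (toℕ l) (suc (toℕ i)))
                                 (dec-true (suc (toℕ i) ℕ.≟ k) last)

  A-shift-row : ∀ {i} l → suc (toℕ i) ≢ k → A i l ≡ δ (toℕ l) (suc (toℕ i))
  A-shift-row {i} l ¬last = ≡.cong (λ b → if b then tq t (k ∸ toℕ l) else δ (toℕ l) (suc (toℕ i)))
                                   (dec-false (suc (toℕ i) ℕ.≟ k) ¬last)

  A⊗hookMatrix : ∀ n i j → (A ⊗ hookMatrix n) i j ≡ hookMatrix (n ℤ.+ + 1) i j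
  A⊗hookMatrix n i j with suc (toℕ i) ℕ.≟ k
  ... | yes last = begin
    ΣF (λ l → A i l ℚ.* hookMatrix n l j)                   ≡⟨ ΣF-cong k (λ l → ≡.cong (ℚ._* hookMatrix n l j) (A-last-row l last)) ⟩
    ΣF {k} (λ l → tq t (k ∸ toℕ l) ℚ.* entry n (toℕ l) (toℕ j)) ≡⟨ ΣF-toℕ k (λ l → tq t (k ∸ l) ℚ.* entry n l (toℕ j)) ⟩
    Σ k (λ l → tq t (k ∸ l) ℚ.* entry n l (toℕ j))          ≡⟨ entry-last n (toℕ j) ⟨
    entry (n ℤ.+ + 1) k′ (toℕ j)                            ≡⟨ ≡.cong (λ m → entry (n ℤ.+ + 1) m (toℕ j)) (ℕ.suc-injective last) ⟨
    hookMatrix (n ℤ.+ + 1) i j                               ∎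
  ... | no ¬last = begin
    ΣF (λ l → A i l ℚ.* hookMatrix n l j)                    ≡⟨ ΣF-cong k (λ l → ≡.cong (ℚ._* hookMatrix n l j) (A-shift-row l ¬last)) ⟩
    ΣF {k} (λ l → δ (toℕ l) (suc (toℕ i)) ℚ.* entry n (toℕ l) (toℕ j))
                                                             ≡⟨ ΣF-toℕ k (λ l → δ l (suc (toℕ i)) ℚ.* entry n l (toℕ j)) ⟩
    Σ k (λ l → δ l (suc (toℕ i)) ℚ.* entry n l (toℕ j))     ≡⟨ Σ-select k (suc (toℕ i)) _ _ (ℕ.≤∧≢⇒< (Fin.toℕ<n i) ¬last)
                                                                  (δ-refl (suc (toℕ i))) (λ l → δ-≢) ⟩
    entry n (suc (toℕ i)) (toℕ j)                            ≡⟨ entry-shift n (toℕ i) (toℕ j) ⟨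
    hookMatrix (n ℤ.+ + 1) i j                               ∎

  A^n≡hookMatrix : ∀ n i j → (A ^ᴹ n) i j ≡ hookMatrix (+ n) i j
  A^n≡hookMatrix zero    i j = ≡.trans (Id≡δ i j) (≡.sym (entry-initial (toℕ i) (toℕ j) (Fin.toℕ<n i) (Fin.toℕ<n j)))
  A^n≡hookMatrix (suc n) i j = begin
    ΣF (λ l → A i l ℚ.* (A ^ᴹ n) l j)       ≡⟨ ΣF-cong k (λ l → ≡.cong (A i l ℚ.*_) (A^n≡hookMatrix n l j)) ⟩
    (A ⊗ hookMatrix (+ n)) i j              ≡⟨ A⊗hookMatrix (+ n) i j ⟩
    hookMatrix (+ n ℤ.+ + 1) i j            ≡⟨ ≡.cong (λ m → hookMatrix (+ m) i j) (ℕ.+-comm n 1) ⟩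
    hookMatrix (+ suc n) i j                ∎

  module Inverse (A⁻¹ : Mat k) (A⁻¹⊗A≡Id : ∀ i j → (A⁻¹ ⊗ A) i j ≡ Id i j) where

    private
      -[1+m]+1≡-m : ∀ m → ℤ.- (+ 1 ℤ.+ m) ℤ.+ + 1 ≡ ℤ.- m
      -[1+m]+1≡-m = solve-∀

    A⁻¹^m≡hookMatrix : ∀ m i j → (A⁻¹ ^ᴹ m) i j ≡ hookMatrix (ℤ.- + m) i j
    A⁻¹^m≡hookMatrix zero      = A^n≡hookMatrix zero
    A⁻¹^m≡hookMatrix (suc m) i j = begin
      ΣF (λ l → A⁻¹ i l ℚ.* (A⁻¹ ^ᴹ m) l j)           ≡⟨ ΣF-cong k (λ l → ≡.cong (A⁻¹ i l ℚ.*_) (previous l)) ⟩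
      (A⁻¹ ⊗ (A ⊗ hookMatrix N)) i j                  ≡⟨ ⊗-assoc A⁻¹ A (hookMatrix N) i j ⟩
      ((A⁻¹ ⊗ A) ⊗ hookMatrix N) i j                  ≡⟨ ΣF-cong k (λ p → ≡.cong (ℚ._* hookMatrix N p j) (A⁻¹⊗A≡Id i p)) ⟩
      (Id ⊗ hookMatrix N) i j                         ≡⟨ Id-select i (λ p → hookMatrix N p j) ⟩
      hookMatrix N i j                                ∎
      where
      N = ℤ.- + suc m
      previous : ∀ l → (A⁻¹ ^ᴹ m) l j ≡ (A ⊗ hookMatrix N) l j
      previous l = begin
        (A⁻¹ ^ᴹ m) l j                     ≡⟨ A⁻¹^m≡hookMatrix m l j ⟩
        hookMatrix (ℤ.- + m) l j           ≡⟨ ≡.cong (λ z → hookMatrix z l j) (-[1+m]+1≡-m (+ m)) ⟨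
        hookMatrix (N ℤ.+ + 1) l j         ≡⟨ A⊗hookMatrix N l j ⟨
        (A ⊗ hookMatrix N) l j             ∎

    powℤ≡hookMatrix : ∀ n i j → powℤ A A⁻¹ n i j ≡ hookMatrix n i j
    powℤ≡hookMatrix (+ n)    = A^n≡hookMatrix n
    powℤ≡hookMatrix -[1+ m ] = A⁻¹^m≡hookMatrix (suc m)

    trace-powℤ : ∀ n → trace (powℤ A A⁻¹ n) ≡ Σ k (λ i → entry n i i)
    trace-powℤ n = ≡.trans (ΣF-cong k (λ i → powℤ≡hookMatrix n i i)) (ΣF-toℕ k (λ i → entry n i i))

    powℤ-LinRec : ∀ i j → LinRec k c (λ n → powℤ A A⁻¹ n i j)
    powℤ-LinRec i j = LinRec-resp (λ n → ≡.sym (powℤ≡hookMatrix n i j)) (entry-LinRec (toℕ i) (toℕ j))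

    powℤ-corner : ∀ n i j → toℕ i ≡ k′ → toℕ j ≡ k′ → powℤ A A⁻¹ n i j ≡ h n
    powℤ-corner n i j i≡k′ j≡k′ =
      ≡.trans (powℤ≡hookMatrix n i j) (≡.trans (≡.cong₂ (entry n) i≡k′ j≡k′) (entry-corner n))

ℤ→ℚ-≢0 : ∀ z → z ≢ + 0 → ℤ→ℚ z ≢ 0ℚ
ℤ→ℚ-≢0 z z≢0 z/1≡0 = z≢0 (begin
  z                                  ≡⟨ ℚ.↥-/ z 1 ⟨
  ℚ.↥ (ℤ→ℚ z) ℤ.* gcd z (+ 1)        ≡⟨ ≡.cong (λ q → ℚ.↥ q ℤ.* gcd z (+ 1)) z/1≡0 ⟩
  + 0 ℤ.* gcd z (+ 1)                ≡⟨ ℤ.*-zeroˡ (gcd z (+ 1)) ⟩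
  + 0                                ∎)
  where open ≡.≡-Reasoning
        open import Data.Integer.GCD using (gcd)

ℚ-left-inverse : ∀ q → q ≢ 0ℚ → ∃ λ r → r ℚ.* q ≡ 1ℚ
ℚ-left-inverse q q≢0 = ℚ.1/_ q {{ℚ.≢-nonZero q≢0}} , ℚ.*-inverseˡ q {{ℚ.≢-nonZero q≢0}}

module PowerExpansion (k′ : ℕ) (t : Fin (suc k′) → ℤ) (t-last≢0 : coef t (suc k′) ≢ + 0)
                      (h : ℤ → ℚ) (h-fib : IsGenFib (suc k′) t h)
                      (K : CommutativeRing 0ℓ 0ℓ) (φ : ℚ → CommutativeRing.Carrier K)
                      (φ-hom : IsRingHomomorphism ℚ.+-*-rawRing (CommutativeRing.rawRing K) φ) where
  open Hooks k′ t h h-fib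
  open CommutativeRing K
  open IsRingHomomorphism φ-hom
  open Sums K
  open LinearRecurrences K
  open Transport ℚ-ring K φ φ-hom
  open import Algebra.Properties.Group +-group using (x∙y⁻¹≈ε⇒x≈y)
  open import Relation.Binary.Reasoning.Setoid setoid

  φ-c-last-invertible : ∃ λ u → u * φ (c k′) ≈ 1#
  φ-c-last-invertible with ℚ-left-inverse (c k′) (ℤ→ℚ-≢0 _ t-last≢0)
  ... | r , r*c≡1 = φ r , trans (sym (*-homo r (c k′))) (trans (⟦⟧-cong r*c≡1) 1#-homo)

  characteristic-equation : ∀ x → Ceval K k t φ x ≈ 0# → powK K x k ≈ Σ k (λ d → φ (tq t (k ∸ d)) * powK K x d)
  characteristic-equation x root = x∙y⁻¹≈ε⇒x≈y _ _ (begin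
    powK K x k - R                                   ≈⟨ +-comm _ _ ⟩
    - R + powK K x k                                 ≈⟨ +-cong (sym lower) (sym (trans (*-congʳ (reflexive (Ccoef-top K k t φ))) (*-identityˡ _))) ⟩
    Ceval K k t φ x                                  ≈⟨ root ⟩
    0#                                               ∎)
    where
    R = Σ k (λ d → φ (tq t (k ∸ d)) * powK K x d)
    lower : Σ k (λ d → Ccoef K k t φ d * powK K x d) ≈ - R
    lower = trans (Σ-cong k (λ d d<k → trans (*-congʳ (reflexive (Ccoef-below K k t φ d<k))) (sym (-‿distribˡ-* _ _))))
                  (Σ-neg k _)
      where open import Algebra.Properties.Ring ring using (-‿distribˡ-*)

  private
    m-k+1≡0-k+[1+m] : ∀ m k → m ℤ.- k ℤ.+ + 1 ≡ + 0 ℤ.- k ℤ.+ (+ 1 ℤ.+ m)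
    m-k+1≡0-k+[1+m] = solve-∀

  module _ (x y : Carrier) (x*y≈1 : x * y ≈ 1#) (root : Ceval K k t φ x ≈ 0#) where
    open UnitPowers K x y x*y≈1

    expansion-LinRec : LinRec k (φ ∘ c) (λ m → Σ k (λ j → φ (entry m 0 j) * powK K x j))
    expansion-LinRec = LinRec-Σ k (λ j → LinRec-resp (λ m → *-comm _ _)
                                           (LinRec-* (powK K x j) (φ-LinRec (entry-LinRec 0 j))))

    expansion-initial : ∀ m → m < k → zpow (+ m) ≈ Σ k (λ j → φ (entry (+ m) 0 j) * powK K x j)
    expansion-initial m m<k = sym (begin
      Σ k (λ j → φ (entry (+ m) 0 j) * powK K x j)       ≈⟨ Σ-cong k (λ j j<k → *-congʳ (⟦⟧-cong (≡.trans
                                                               (≡.cong (hook (k ∸ suc j)) (m-k+1≡0-k+[1+m] (+ m) (+ k)))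
                                                               (entry-initial m j m<k j<k)))) ⟩
      Σ k (λ j → φ (δ m j) * powK K x j)                 ≈⟨ Σ-select k m (φ ∘ δ m) (powK K x) m<k
                                                              (trans (⟦⟧-cong (δ-refl m)) 1#-homo)
                                                              (λ j j≢m → trans (⟦⟧-cong (δ-≢ (j≢m ∘ ≡.sym))) 0#-homo) ⟩
      powK K x m                                         ∎)

    zpow-expansion : ∀ m → zpow m ≈ Σ k (λ j → φ (entry m 0 j) * powK K x j)
    zpow-expansion = LinRec-unique (zpow-LinRec k (φ ∘ tq t) (characteristic-equation x root)) expansion-LinRec
                                   φ-c-last-invertible expansion-initial

module TracePowerSums (k′ : ℕ) (t : Fin (suc k′) → ℤ) (t-last≢0 : coef t (suc k′) ≢ + 0)
                      (h : ℤ → ℚ) (h-fib : IsGenFib (suc k′) t h)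
                      (K : CommutativeRing 0ℓ 0ℓ) (φ : ℚ → CommutativeRing.Carrier K)
                      (φ-hom : IsRingHomomorphism ℚ.+-*-rawRing (CommutativeRing.rawRing K) φ)
                      (xs ys : Fin (suc k′) → CommutativeRing.Carrier K)
                      (xs*ys≈1 : ∀ i → CommutativeRing._≈_ K (CommutativeRing._*_ K (xs i) (ys i)) (CommutativeRing.1# K))
                      (xs-roots : ∀ d → CommutativeRing._≈_ K (rootPoly K xs d) (Ccoef K (suc k′) t φ d)) where
  open Hooks k′ t h h-fib
  open PowerExpansion k′ t t-last≢0 h h-fib K φ φ-hom
  open CommutativeRing K
  open IsRingHomomorphism φ-hom
  open Sums K
  open LinearRecurrences K
  open Transport ℚ-ring K φ φ-hom
  open RootPolynomials K
  open import Algebra.Properties.Semiring.Mult semiring using (_×_; ×-congʳ; ×-assoc-*)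
  open import Algebra.Properties.CommutativeSemigroup *-commutativeSemigroup using (xy∙z≈x∙zy; x∙yz≈y∙xz)
  open import Relation.Binary.Reasoning.Setoid setoid

  G : ℤ → Carrier
  G n = ΣF (λ i → zpowK K (xs i) (ys i) n)

  rootPoly≈φC : ∀ d → rootPoly K xs d ≈ φ (C d)
  rootPoly≈φC d = trans (xs-roots d) (sym (φ-Ccoef k t id d))

  xs-root-of-C : ∀ i → Ceval K k t φ (xs i) ≈ 0#
  xs-root-of-C i = trans (Σ-cong (suc k) (λ d _ → *-congʳ (sym (xs-roots d)))) (eval-rootPoly-root xs i)

  private
    φh : ℤ → ℕ → Carrier
    φh n v = φ (h (n ℤ.- + k ℤ.+ + v))

    g : ℤ → ℕ → Carrier
    g n v = φ (C v) * φh n v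

    n-k+[1+i]+e≡n-k+[e+[1+i]] : ∀ n k i e → (n ℤ.- k ℤ.+ (+ 1 ℤ.+ i)) ℤ.+ e ≡ n ℤ.- k ℤ.+ (e ℤ.+ (+ 1 ℤ.+ i))
    n-k+[1+i]+e≡n-k+[e+[1+i]] = solve-∀
    [n-1]-k+1≡n-k : ∀ n k → (n ℤ.- + 1) ℤ.- k ℤ.+ + 1 ≡ n ℤ.- k
    [n-1]-k+1≡n-k = solve-∀
    [n-1]+1≡n : ∀ n → (n ℤ.- + 1) ℤ.+ + 1 ≡ n
    [n-1]+1≡n = solve-∀

  φ-diagonal-entry : ∀ n i → i < k → φ (entry n i i) ≈ Σ (suc k) (λ e → g n (e ℕ.+ suc i))
  φ-diagonal-entry n i i<k = begin
    φ (entry n i i)                                            ≡⟨ ≡.cong φ (hook-convolution (k ∸ suc i) (n ℤ.- + k ℤ.+ + suc i) (ℕ.m∸n≤m k (suc i))) ⟩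
    φ (Σℚ (suc k) (λ e → C (e ℕ.+ (k ∸ (k ∸ suc i))) ℚ.* h ((n ℤ.- + k ℤ.+ + suc i) ℤ.+ + e)))
                                                               ≈⟨ φ-Σ (suc k) _ ⟩
    Σ (suc k) (λ e → φ (C (e ℕ.+ (k ∸ (k ∸ suc i))) ℚ.* h ((n ℤ.- + k ℤ.+ + suc i) ℤ.+ + e)))
      ≈⟨ Σ-cong (suc k) (λ e _ → trans (*-homo _ _) (reflexive (≡.cong₂ (λ d z → φ (C (e ℕ.+ d)) * φ (h z))
                                   (ℕ.m∸[m∸n]≡n i<k)
                                   (≡.trans (n-k+[1+i]+e≡n-k+[e+[1+i]] n (+ k) (+ i) (+ e))
                                            (≡.cong (λ z → n ℤ.- + k ℤ.+ z) (≡.sym (ℤ.pos-+ e (suc i)))))))) ⟩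
    Σ (suc k) (λ e → g n (e ℕ.+ suc i))                        ∎

  trace-weighted : ∀ n → φ (Σℚ k (λ i → entry n i i)) ≈ Σ (suc k) (λ v → v × g n v)
  trace-weighted n = begin
    φ (Σℚ k (λ i → entry n i i))                                ≈⟨ φ-Σ k _ ⟩
    Σ k (λ i → φ (entry n i i))                                ≈⟨ Σ-cong k (λ i i<k → φ-diagonal-entry n i i<k) ⟩
    Σ k (λ i → Σ (suc k) (λ e → g n (e ℕ.+ suc i)))            ≈⟨ Σ-tails k (g n) (λ v k<v → trans (*-congʳ (trans
                                                                    (⟦⟧-cong (C-> k<v)) 0#-homo)) (zeroˡ _)) ⟩
    Σ (suc k) (λ v → v × g n v)                                ∎

  private
    p : ℕ → Carrier
    p = powerSum xs

    φ-convolution : ∀ n r → r ≤ k → Σ (suc k) (λ v → φ (C (v ℕ.+ r)) * φh n v) ≈ φ (hook (k ∸ r) (n ℤ.- + k))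
    φ-convolution n r r≤k = sym (begin
      φ (hook (k ∸ r) (n ℤ.- + k))                                   ≡⟨ ≡.cong φ (hook-convolution (k ∸ r) (n ℤ.- + k) (ℕ.m∸n≤m k r)) ⟩
      φ (Σℚ (suc k) (λ v → C (v ℕ.+ (k ∸ (k ∸ r))) ℚ.* h ((n ℤ.- + k) ℤ.+ + v)))
                                                                     ≈⟨ φ-Σ (suc k) _ ⟩
      Σ (suc k) (λ v → φ (C (v ℕ.+ (k ∸ (k ∸ r))) ℚ.* h ((n ℤ.- + k) ℤ.+ + v)))
                                                                     ≈⟨ Σ-cong (suc k) (λ v _ → trans (*-homo _ _)
                                                                          (reflexive (≡.cong (λ d → φ (C (v ℕ.+ d)) * φh n v) (ℕ.m∸[m∸n]≡n r≤k)))) ⟩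
      Σ (suc k) (λ v → φ (C (v ℕ.+ r)) * φh n v)                     ∎)

  weighted-power-sums : ∀ n → Σ (suc k) (λ v → v × g n v) ≈ Σ k (λ j → p (suc j) * φ (entry (n ℤ.- + 1) 0 j))
  weighted-power-sums n = begin
    Σ (suc k) (λ v → v × g n v)
      ≈⟨ Σ-cong (suc k) (λ v _ → trans (sym (×-assoc-* v _ _)) (*-congʳ (trans (×-congʳ v (sym (rootPoly≈φC v))) (newton xs v)))) ⟩
    Σ (suc k) (λ v → Σ (suc k) (λ r → rootPoly K xs (v ℕ.+ r) * p r) * φh n v)
      ≈⟨ Σ-cong (suc k) (λ v _ → trans (*-distribʳ-Σ (suc k) _ _) (Σ-cong (suc k) (λ r _ →
           trans (*-congʳ (*-congʳ (rootPoly≈φC (v ℕ.+ r)))) (trans (*-congʳ (*-comm _ _)) (*-assoc _ _ _))))) ⟩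
    Σ (suc k) (λ v → Σ (suc k) (λ r → p r * (φ (C (v ℕ.+ r)) * φh n v)))
      ≈⟨ Σ-comm (suc k) (suc k) _ ⟩
    Σ (suc k) (λ r → Σ (suc k) (λ v → p r * (φ (C (v ℕ.+ r)) * φh n v)))
      ≈⟨ Σ-cong (suc k) (λ r r≤k → trans (sym (*-distribˡ-Σ (suc k) (p r) _)) (*-congˡ (φ-convolution n r (ℕ.≤-pred r≤k)))) ⟩
    Σ (suc k) (λ r → p r * φ (hook (k ∸ r) (n ℤ.- + k)))              ≈⟨ Σ-head k _ ⟩
    p 0 * φ (hook k (n ℤ.- + k)) + Σ k (λ j → p (suc j) * φ (hook (k ∸ suc j) (n ℤ.- + k)))
      ≈⟨ +-cong (trans (*-congˡ (trans (⟦⟧-cong (hook-k (n ℤ.- + k))) 0#-homo)) (zeroʳ _))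
                (Σ-cong k (λ j _ → *-congˡ (⟦⟧-cong (≡.cong (hook (k ∸ suc j)) (≡.sym ([n-1]-k+1≡n-k n (+ k))))))) ⟩
    0# + Σ k (λ j → p (suc j) * φ (entry (n ℤ.- + 1) 0 j))            ≈⟨ +-identityˡ _ ⟩
    Σ k (λ j → p (suc j) * φ (entry (n ℤ.- + 1) 0 j))                 ∎

  power-sums-G : ∀ n → Σ k (λ j → p (suc j) * φ (entry (n ℤ.- + 1) 0 j)) ≈ G n
  power-sums-G n = begin
    Σ k (λ j → p (suc j) * E j)
      ≈⟨ Σ-cong k (λ j _ → trans (*-distribʳ-ΣF k (E j) (λ i → powK K (xs i) (suc j)))
                                   (ΣF-cong k (λ i → xy∙z≈x∙zy (xs i) (powK K (xs i) j) (E j)))) ⟩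
    Σ k (λ j → ΣF {k} (λ i → xs i * (E j * powK K (xs i) j)))             ≈⟨ ΣF-Σ-comm k k (λ i j → xs i * (E j * powK K (xs i) j)) ⟨
    ΣF {k} (λ i → Σ k (λ j → xs i * (E j * powK K (xs i) j)))             ≈⟨ ΣF-cong k (λ i → sym (*-distribˡ-Σ k (xs i) (λ j → E j * powK K (xs i) j))) ⟩
    ΣF {k} (λ i → xs i * Σ k (λ j → E j * powK K (xs i) j))
      ≈⟨ ΣF-cong k (λ i → *-congˡ {xs i} (sym (zpow-expansion (xs i) (ys i) (xs*ys≈1 i) (xs-root-of-C i) (n ℤ.- + 1)))) ⟩
    ΣF {k} (λ i → xs i * zpowK K (xs i) (ys i) (n ℤ.- + 1))
      ≈⟨ ΣF-cong k (λ i → sym (trans (reflexive (≡.cong (zpowK K (xs i) (ys i)) (≡.sym ([n-1]+1≡n n))))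
                                     (UnitPowers.zpow-suc K (xs i) (ys i) (xs*ys≈1 i) (n ℤ.- + 1)))) ⟩
    G n                                                               ∎
    where
    E : ℕ → Carrier
    E j = φ (entry (n ℤ.- + 1) 0 j)

  trace≈G : ∀ n → φ (Σℚ k (λ i → entry n i i)) ≈ G n
  trace≈G n = trans (trace-weighted n) (trans (weighted-power-sums n) (power-sums-G n))

  G-LinRec : LinRec k (φ ∘ c) G
  G-LinRec = LinRec-resp trace≈G (φ-LinRec (LR.LinRec-Σ k (λ i → entry-LinRec i i)))
    where module LR = LinearRecurrences ℚ-ring

open import Data.Product using (_×_)

theorem3p1 :
  (k : ℕ) → 1 ℕ.≤ k →
  (t : Fin k → ℤ) → ¬ (coef t k ≡ + 0) →
  (h : ℤ → ℚ) → IsGenFib k t h →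
  (Ainv : Mat k) → IsInverse (companion k t) Ainv →
  let P : ℤ → Mat k
      P n = powℤ (companion k t) Ainv n
  in
  -- (a)
  (∀ (n : ℤ) (i j : Fin k) →
     P n i j ≡ sgn (k ∸ suc (toℕ j)) ℚ.* S t h (n ℤ.- + k ℤ.+ + suc (toℕ i)) (k ∸ suc (toℕ j)))
  -- (b)
  × (∀ (K : CommutativeRing 0ℓ 0ℓ) → IsFieldCR K →
     (φ : ℚ → CommutativeRing.Carrier K) →
     IsRingHomomorphism ℚ.+-*-rawRing (CommutativeRing.rawRing K) φ →
     let open CommutativeRing K in
     (lam mu : Carrier) → lam * mu ≈ 1# → Ceval K k t φ lam ≈ 0# →
     ∀ (m : ℤ) →
       zpowK K lam mu m
         ≈ ΣK K k (λ j → φ (sgn (k ∸ suc j) ℚ.* S t h (m ℤ.- + k ℤ.+ + 1) (k ∸ suc j)) * powK K lam j))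
  -- (c)
  × (∀ (i j : Fin k) (n : ℤ) →
       P n i j ≡ Σℚ k (λ l → tq t (suc l) ℚ.* P (n ℤ.- + suc l) i j))
  × (∀ (n : ℤ) (i j : Fin k) → toℕ i ≡ k ∸ 1 → toℕ j ≡ k ∸ 1 → P n i j ≡ h n)
  -- (d)
  × (∀ (K : CommutativeRing 0ℓ 0ℓ) → IsFieldCR K →
     (φ : ℚ → CommutativeRing.Carrier K) →
     IsRingHomomorphism ℚ.+-*-rawRing (CommutativeRing.rawRing K) φ →
     let open CommutativeRing K in
     (lams mus : Fin k → Carrier) → (∀ i → lams i * mus i ≈ 1#) →
     (∀ (d : ℕ) → rootPoly K lams d ≈ Ccoef K k t φ d) →
     let G : ℤ → Carrier
         G n = ΣFinK K (λ i → zpowK K (lams i) (mus i) n)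
     in (∀ (n : ℤ) → φ (trace (P n)) ≈ G n)
        × (∀ (n : ℤ) → G n ≈ ΣK K k (λ l → φ (tq t (suc l)) * G (n ℤ.- + suc l))))
theorem3p1 (suc k′) _ t t-last≢0 h h-fib A⁻¹ (_ , A⁻¹⊗A≡Id) =
    powℤ≡hookMatrix
  , (λ K _ φ φ-hom → PowerExpansion.zpow-expansion k′ t t-last≢0 h h-fib K φ φ-hom)
  , (λ i j → LinearRecurrences.recur (powℤ-LinRec i j))
  , powℤ-corner
  , λ K _ φ φ-hom xs ys xs*ys≈1 xs-roots →
      let open TracePowerSums k′ t t-last≢0 h h-fib K φ φ-hom xs ys xs*ys≈1 xs-roots
      in (λ n → CommutativeRing.trans K (IsRingHomomorphism.⟦⟧-cong φ-hom (trace-powℤ n)) (trace≈G n))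
       , LinearRecurrences.recur G-LinRec
  where open CompanionPowers.Inverse k′ t h h-fib A⁻¹ A⁻¹⊗A≡Id
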